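{- (i) Let $n$ be a positive integer, $w=(w_1,\dots,w_n)$ an $n$-tuple of positive integers, and $r\in\mathbb N$. Then, in $\mathbb Q[[t]]$, \[\frac{\prod_{i=1}^r(1-t^i)}{\prod_{i=1}^n(1-t^{w_i})}=\sum_{m\in\mathbb N}\Big(\sum_{T\subseteq[r]}(-1)^{|T|}D_w(m-\omega(T))\Big)t^m.\] (ii) Let $n$ be a positive integer and $d:d_1<\cdots<d_r$ positive integers with $d_r<n$. For all $k\in\mathbb N$, \[I_n(d;k)=\sum_{T\subseteq[n]}(-1)^{|T|}D_{\varepsilon(d,n)}(k-\omega(T))=\sum_{i=0}^k\psi_n(i)D_{\varepsilon(d,n)}(k-i).\] (iii) For all $k\in\mathbb N$, \[I_n(k)=\sum_{T\subseteq[n]}(-1)^{|T|}\binom{n-1+k-\omega(T)}{n-1}=\sum_{i=0}^k\psi_n(i)\binom{n-1+k-i}{n-1}.\] (iv) Let $d^*$ be a refinement of $d$ and for $1\le i\le r+1$ let $d[i]^*$ be the (possibly empty) sequence obtained by listing the members $x$ of $d^*$ with $d_{i-1}<x<d_i$ and replacing each by $x-d_{i-1}$ (a sequence of positive integers $<e_i$). Let $\mathcal A_m:=\{(j_1,\dots,j_{r+1})\in\mathbb N^{r+1}: j_1+\cdots+j_{r+1}=m\}$. Then for all $k\in\mathbb N$, \[I_n(d;k)=I_n(d^*;k)-\sum_{m=1}^k\Big(\sum_{(j_1,\dots,j_{r+1})\in\mathcal A_m}\prod_{i=1}^{r+1}I_{e_i}(d[i]^*;j_i)\Big)I_n(d;k-m).\]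 In particular $I_n(d;k)\le I_n(d^*;k)$. (v) Let $\nu(d):=\sum_{1\le i<j\le r+1}e_ie_j$. Then $\nu(d)\le n(n-1)/2$, $I_n(d;k)=I_n(d;\nu(d)-k)$ for all $k\in\mathbb N$, and $I_n(d;k)\ge1$ for $0\le k\le\nu(d)$.
   Context: $[n]=\{1,\dots,n\}$, $[0]=\emptyset$. For a tuple $w$ of positive integers, $D_w(m)$ ($m\in\mathbb Z$) is defined by $\prod_{i=1}^n(1-t^{w_i})^{ -1}=\sum_{m}D_w(m)t^m$; so $D_w(m)=0$ for $m<0$ and $D_w(m)$ is the number of $(i_1,\dots,i_n)\in\mathbb N^n$ with $\sum i_jw_j=m$. For $T\subseteq[n]$, $\omega(T):=\sum_{i\in T}i$; $\psi_n(r):=\sum_{T\subseteq[n],\,\omega(T)=r}(-1)^{|T|}$. For $a,b\in\mathbb Z$, $\binom ab:=0$ if $\min\{a,b\}<0$ or $a<b$, and $\binom ab=\prod_{i=0}^{b-1}\frac{a-i}{i+1}$ if $0\le b\le a$. For $d:d_1<\cdots<d_r$ with $d_r<n$ put $d_0:=0$, $d_{r+1}:=n$, $e_i:=d_i-d_{i-1}$ ($1\le i\le r+1$); $d$ may be the empty sequence ($r=0$). $\varepsilon(d,n):=(w_1,\dots,w_n)$ with $w_i=i-d_j$ whenever $d_j<i\le d_{j+1}$. $I_n(d;k)$ is the number of words of length $n$ in which each letter $i\in[r+1]$ occurs exactly $e_i$ times having exactly $k$ inversions (pairs of positions $p<p'$ with the letter at $p$ larger than that at $p'$). $I_n(k):=I_n(d;k)$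 for $d:1<2<\cdots<n-1$, i.e. the number of permutations of $[n]$ with exactly $k$ inversions. A refinement of $d$ is a sequence $d^*:d^*_1<\cdots<d^*_s<n$ of positive integers containing every $d_i$. -}

module Defs where

open import Data.Bool using (Bool; true; false; if_then_else_; _∧_)
open import Data.Nat using (ℕ; zero; suc; _+_; _*_; _∸_; _⊔_; _≡ᵇ_; _<ᵇ_; _≤ᵇ_; _<_)
open import Data.Nat.Combinatorics using (_C_)
open import Data.Integer as ℤ using (ℤ; +_; -[1+_])
open import Data.Fin using (Fin; toℕ)
open import Data.Vec using (Vec; []; _∷_; lookup)
open import Data.List using (List; []; _∷_; _++_; map; concatMap; upTo; allFin; length)
open import Data.Nat.ListAction using (sum)
open import Relation.Binary.PropositionalEquality using (_≡_)
open import Data.List.Relation.Unary.All using (All)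
open import Data.List.Relation.Unary.Linked using (Linked)
open import Data.List.Membership.Propositional using (_∈_)
open import Data.Product using (_×_; _,_)

sumℤ : List ℤ → ℤ
sumℤ [] = + 0
sumℤ (x ∷ xs) = x ℤ.+ sumℤ xs

sumTo : ℕ → (ℕ → ℤ) → ℤ
sumTo zero f = f 0
sumTo (suc m) f = sumTo m f ℤ.+ f (suc m)

sumToℕ : ℕ → (ℕ → ℕ) → ℕ
sumToℕ zero f = f 0
sumToℕ (suc m) f = sumToℕ m f + f (suc m)

countB : {A : Set} → (A → Bool) → List A → ℕ
countB p [] = 0
countB p (x ∷ xs) = (if p x then 1 else 0) + countB p xs

filterB : {A : Set} → (A → Bool) → List A → List A
filterB p [] = []
filterB p (x ∷ xs) = if p x then x ∷ filterB p xs else filterB p xs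

allB : {A : Set} → (A → Bool) → List A → Bool
allB p [] = true
allB p (x ∷ xs) = p x ∧ allB p xs

sgn : ℕ → ℤ
sgn zero = + 1
sgn (suc k) = ℤ.- sgn k

oneTo : ℕ → List ℕ
oneTo n = map suc (upTo n)

-- all sub-lists (= subsets, for a list without repetitions)
subsetsOf : List ℕ → List (List ℕ)
subsetsOf [] = [] ∷ []
subsetsOf (x ∷ xs) = subsetsOf xs ++ map (x ∷_) (subsetsOf xs)

-- ω(T) = Σ_{i∈T} i  is  sum T ;  |T| = length T

altSubsetSum : ℕ → (ℕ → ℤ) → ℤ
altSubsetSum r f = sumℤ (map (λ T → sgn (length T) ℤ.* f (sum T)) (subsetsOf (oneTo r)))

ψ : ℕ → ℕ → ℤ
ψ n i = sumℤ (map (λ T → if sum T ≡ᵇ i then sgn (length T) else + 0) (subsetsOf (oneTo n)))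

-- D_w(m): number of (i_1,…,i_n) ∈ ℕ^n with Σ i_j w_j = m
-- (recursion on the first coordinate i_1 ∈ {0,…,m}; for positive
--  weights every solution has i_1 ≤ m)

D : List ℕ → ℕ → ℕ
D [] m = if m ≡ᵇ 0 then 1 else 0
D (w ∷ ws) m = sumToℕ m (λ i → if i * w ≤ᵇ m then D ws (m ∸ i * w) else 0)

Dℤ : List ℕ → ℤ → ℕ
Dℤ w (+ m) = D w m
Dℤ w -[1+ _ ] = 0

-- Formal power series with integer coefficients (ℤ[[t]] ⊆ ℚ[[t]])

Series : Set
Series = ℕ → ℤ

δ : ℕ → ℕ → ℤ
δ a b = if a ≡ᵇ b then + 1 else + 0

_⊛_ : Series → Series → Series
(f ⊛ g) m = sumTo m (λ i → f i ℤ.* g (m ∸ i))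

oneS : Series
oneS m = δ m 0

oneMinusT : ℕ → Series
oneMinusT k m = δ m 0 ℤ.- δ m k

prodS : List Series → Series
prodS [] = oneS
prodS (f ∷ fs) = f ⊛ prodS fs

_≈S_ : Series → Series → Set
f ≈S g = ∀ m → f m ≡ g m

infixl 7 _⊛_
infix 4 _≈S_

Valid : ℕ → List ℕ → Set
Valid n d = Linked _<_ d × All (λ x → 0 < x) d × All (λ x → x < n) d

Refines : ℕ → List ℕ → List ℕ → Set
Refines n dstar d = Valid n dstar × All (λ x → x ∈ dstar) d

-- e_i = d_i - d_{i-1}, 1 ≤ i ≤ r+1 (d_0 = 0, d_{r+1} = n), as a vector
gaps : ℕ → (d : List ℕ) → ℕ → Vec ℕ (suc (length d))
gaps prev [] n = (n ∸ prev) ∷ []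
gaps prev (x ∷ xs) n = (x ∸ prev) ∷ gaps x xs n

blocks : ℕ → List ℕ → ℕ → List (ℕ × ℕ)
blocks prev [] n = (prev , n) ∷ []
blocks prev (x ∷ xs) n = (prev , x) ∷ blocks x xs n

eList : ℕ → List ℕ → List ℕ
eList n d = map (λ { (lo , hi) → hi ∸ lo }) (blocks 0 d n)

-- ε(d,n): w_i = i - d_j where d_j < i ≤ d_{j+1}; d_j is the largest
-- element of {d_0 = 0, d_1, …, d_r} that is < i
below : ℕ → List ℕ → ℕ
below i [] = 0
below i (x ∷ xs) = if x <ᵇ i then x ⊔ below i xs else below i xs

ε : List ℕ → ℕ → List ℕ
ε d n = map (λ i → i ∸ below i d) (oneTo n)

allWords : (a n : ℕ) → List (Vec (Fin a) n)
allWords a zero = [] ∷ []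
allWords a (suc n) = concatMap (λ x → map (x ∷_) (allWords a n)) (allFin a)

occ : {a n : ℕ} → Fin a → Vec (Fin a) n → ℕ
occ x [] = 0
occ x (y ∷ ys) = (if toℕ x ≡ᵇ toℕ y then 1 else 0) + occ x ys

smallerAfter : {a n : ℕ} → Fin a → Vec (Fin a) n → ℕ
smallerAfter x [] = 0
smallerAfter x (y ∷ ys) = (if toℕ y <ᵇ toℕ x then 1 else 0) + smallerAfter x ys

inv : {a n : ℕ} → Vec (Fin a) n → ℕ
inv [] = 0
inv (x ∷ xs) = smallerAfter x xs + inv xs

-- I_n(d;k): letters 1..r+1 are represented by Fin (r+1) (order-preserving)
I : ℕ → List ℕ → ℕ → ℕ
I n d k = countB (λ v → allB (λ i → occ i v ≡ᵇ lookup (gaps 0 d n) i) (allFin (suc (length d)))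
                        ∧ (inv v ≡ᵇ k))
                 (allWords (suc (length d)) n)

Iℤ : ℕ → List ℕ → ℤ → ℕ
Iℤ n d (+ k) = I n d k
Iℤ n d -[1+ _ ] = 0

Iperm : ℕ → ℕ → ℕ
Iperm n k = I n (oneTo (n ∸ 1)) k

-- binomial coefficient with integer top (0 if top < 0, and a C b = 0 if a < b)
binomℤ : ℤ → ℕ → ℕ
binomℤ (+ a) b = a C b
binomℤ -[1+ _ ] b = 0

subRef : List ℕ → ℕ → ℕ → List ℕ
subRef dstar lo hi = map (λ x → x ∸ lo) (filterB (λ x → (lo <ᵇ x) ∧ (x <ᵇ hi)) dstar)

blockFactors : ℕ → List ℕ → List ℕ → List (ℕ → ℕ)
blockFactors n d dstar = map (λ { (lo , hi) → λ j → I (hi ∸ lo) (subRef dstar lo hi) j }) (blocks 0 d n)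

compSum : List (ℕ → ℕ) → ℕ → ℕ
compSum [] m = if m ≡ᵇ 0 then 1 else 0
compSum (f ∷ fs) m = sumToℕ m (λ j → f j * compSum fs (m ∸ j))

pairSum : List ℕ → ℕ
pairSum [] = 0
pairSum (x ∷ xs) = x * sum xs + pairSum xs

ν : ℕ → List ℕ → ℕ
ν n d = pairSum (eList n d)

-- Everything is computed with integer series and the operators t^k· (shift) and
-- Δ_k = (1 - t^k)·, which commute, are injective for k > 0, and satisfy
-- Δ_w D_(w ∷ ws) = D_ws; hence Π_{w}(1 - t^w) · Σ_m D_w(m) t^m = 1, which gives (i).
-- Sorting words by their first letter x gives W_c = Σ_x t^(c_1 + ⋯ + c_(x-1)) W_(c - e_x)
-- for the inversion series W_c of the words with content c, and by induction and
-- telescoping Π_i Π_{j ≤ c_i} (1 - t^j) · W_c = Π_{j ≤ n} (1 - t^j).  The multiset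
-- {j ≤ e_i} is exactly ε(d, n), so cancelling Δ's yields (ii), and (iii) is the case
-- ε = (1, …, 1).  For a refinement d*, the factors {j ≤ e*_l} split along the blocks
-- of d, which gives W_{d*} = (Π_i W_{d[i]*}) · W_d and (iv).  Reversing the
-- coefficients of Π_{j ≤ n} (1 - t^j) only changes its sign, so W_c is palindromic of
-- degree ν; positivity follows by greedily choosing the first letter.

module Submission where

open import Defs
open import Data.Bool using (Bool; true; false; if_then_else_; _∧_)
import Data.Bool.Properties as Boolₚ
open import Data.Empty using (⊥-elim)
open import Data.Fin using (Fin; zero; suc; toℕ)
open import Data.Integer as ℤ using (ℤ; +_; -[1+_]; _⊖_)
import Data.Integer.Properties as ℤₚ
open import Data.Integer.Tactic.RingSolver using (solve-∀)
open import Data.List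
  using (List; []; _∷_; _++_; _∷ʳ_; map; concatMap; upTo; applyUpTo; replicate; tabulate; allFin; length)
import Data.List.Properties as Listₚ
open import Data.List.Membership.Propositional using (_∈_)
open import Data.List.Relation.Binary.Permutation.Propositional as ↭
  using (_↭_; ↭-sym; ↭-trans)
import Data.List.Relation.Binary.Permutation.Propositional.Properties as ↭ₚ
open import Data.List.Relation.Unary.All as All using (All; []; _∷_)
import Data.List.Relation.Unary.All.Properties as Allₚ
open import Data.List.Relation.Unary.AllPairs using (AllPairs; []; _∷_)
open import Data.List.Relation.Unary.Any using (here; there)
open import Data.List.Relation.Unary.Linked as Linked using (Linked; []; [-]; _∷_)
import Data.List.Relation.Unary.Linked.Properties as Linkedₚ
open import Data.Nat using (ℕ; zero; suc; >-nonZero; _+_; _*_; _∸_; _⊔_; _≤_; _<_; _≤ᵇ_; _<ᵇ_; _≡ᵇ_; z≤n; s≤s; _/_)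
open import Data.Nat.Combinatorics using (_C_; nCk+nC[k+1]≡[n+1]C[k+1]; k>n⇒nCk≡0; nCn≡1)
import Data.Nat.DivMod as ℕ÷
open import Data.Nat.Induction using (<-rec)
open import Data.Nat.ListAction using (sum)
import Data.Nat.ListAction.Properties as Sumₚ
import Data.Nat.Properties as ℕₚ
import Data.Nat.Tactic.RingSolver as ℕ-Solver
open import Data.Product using (Σ; _×_; _,_; proj₁; proj₂)
open import Data.Sum using (inj₁; inj₂)
open import Data.Vec using (Vec; []; _∷_; lookup; toList)
open import Function using (_∘_; Equivalence)
open import Relation.Nullary using (¬_; yes; no)
open import Relation.Binary.Definitions using (tri<; tri≈; tri>)
open import Level using (0ℓ)
open import Relation.Binary.Bundles using (Setoid)
import Relation.Binary.Reasoning.Setoid as SetoidReasoning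
open import Relation.Binary.PropositionalEquality

≤ᵇ-true : ∀ {m n} → m ≤ n → (m ≤ᵇ n) ≡ true
≤ᵇ-true m≤n = Equivalence.to Boolₚ.T-≡ (ℕₚ.≤⇒≤ᵇ m≤n)

≤ᵇ-true⁻ : ∀ {m n} → (m ≤ᵇ n) ≡ true → m ≤ n
≤ᵇ-true⁻ {m} {n} m≤ᵇn = ℕₚ.≤ᵇ⇒≤ m n (Equivalence.from Boolₚ.T-≡ m≤ᵇn)

≤ᵇ-false : ∀ {m n} → n < m → (m ≤ᵇ n) ≡ false
≤ᵇ-false {m} {n} n<m with m ≤ᵇ n in eq
... | false = refl
... | true = ⊥-elim (ℕₚ.<⇒≱ n<m (≤ᵇ-true⁻ eq))

<ᵇ-true : ∀ {m n} → m < n → (m <ᵇ n) ≡ true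
<ᵇ-true = ≤ᵇ-true

<ᵇ-false : ∀ {m n} → n ≤ m → (m <ᵇ n) ≡ false
<ᵇ-false n≤m = ≤ᵇ-false (s≤s n≤m)

≡ᵇ-refl : ∀ m → (m ≡ᵇ m) ≡ true
≡ᵇ-refl zero = refl
≡ᵇ-refl (suc m) = ≡ᵇ-refl m

≡ᵇ-false : ∀ {m n} → ¬ m ≡ n → (m ≡ᵇ n) ≡ false
≡ᵇ-false {zero} {zero} m≢n = ⊥-elim (m≢n refl)
≡ᵇ-false {zero} {suc n} _ = refl
≡ᵇ-false {suc m} {zero} _ = refl
≡ᵇ-false {suc m} {suc n} m≢n = ≡ᵇ-false (λ m≡n → m≢n (cong suc m≡n))

≡ᵇ-sym : ∀ m n → (m ≡ᵇ n) ≡ (n ≡ᵇ m)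
≡ᵇ-sym zero zero = refl
≡ᵇ-sym zero (suc n) = refl
≡ᵇ-sym (suc m) zero = refl
≡ᵇ-sym (suc m) (suc n) = ≡ᵇ-sym m n

≤ᵇ-cong-⇔ : ∀ {a b c d} → (a ≤ b → c ≤ d) → (c ≤ d → a ≤ b) → (a ≤ᵇ b) ≡ (c ≤ᵇ d)
≤ᵇ-cong-⇔ {a} {b} {c} {d} to from with ℕₚ.≤-<-connex a b | ℕₚ.≤-<-connex c d
... | inj₁ a≤b | _ = trans (≤ᵇ-true a≤b) (sym (≤ᵇ-true (to a≤b)))
... | inj₂ b<a | inj₁ c≤d = ⊥-elim (ℕₚ.<⇒≱ b<a (from c≤d))
... | inj₂ b<a | inj₂ d<c = trans (≤ᵇ-false b<a) (sym (≤ᵇ-false d<c))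

<ᵇ-true⁻ : ∀ {m n} → (m <ᵇ n) ≡ true → m < n
<ᵇ-true⁻ {m} {n} m<ᵇn = ℕₚ.<ᵇ⇒< m n (Equivalence.from Boolₚ.T-≡ m<ᵇn)


∧-true⁻ : ∀ {a b} → (a ∧ b) ≡ true → (a ≡ true) × (b ≡ true)
∧-true⁻ {true} {true} _ = refl , refl

suc-≡ᵇ : ∀ o c → (suc o ≡ᵇ c) ≡ ((1 ≤ᵇ c) ∧ (o ≡ᵇ c ∸ 1))
suc-≡ᵇ o zero = refl
suc-≡ᵇ o (suc c) = refl

+-≡ᵇ : ∀ s t k → (s + t ≡ᵇ k) ≡ ((s ≤ᵇ k) ∧ (t ≡ᵇ k ∸ s))
+-≡ᵇ zero t k = refl
+-≡ᵇ (suc s) t zero = refl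
+-≡ᵇ (suc zero) t (suc k) = refl
+-≡ᵇ (suc (suc s)) t (suc k) = +-≡ᵇ (suc s) t k

∧-exchangeˡ : ∀ a b c → a ∧ (b ∧ c) ≡ b ∧ (a ∧ c)
∧-exchangeˡ true b c = refl
∧-exchangeˡ false true c = refl
∧-exchangeˡ false false c = refl

if-distrib-+ : ∀ (b : Bool) m n → (if b then m + n else 0) ≡ (if b then m else 0) + (if b then n else 0)
if-distrib-+ true m n = refl
if-distrib-+ false m n = refl

infixl 6 _+S_ _-S_
infixr 7 _·S_

0S : Series
0S _ = + 0

_+S_ _-S_ : Series → Series → Series
(f +S g) m = f m ℤ.+ g m
(f -S g) m = f m ℤ.- g m

-S_ : Series → Series
(-S f) m = ℤ.- f m

_·S_ : ℤ → Series → Series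
(c ·S f) m = c ℤ.* f m

≈S-refl : ∀ {f} → f ≈S f
≈S-refl m = refl

≈S-sym : ∀ {f g} → f ≈S g → g ≈S f
≈S-sym f≈g m = sym (f≈g m)

≈S-trans : ∀ {f g h} → f ≈S g → g ≈S h → f ≈S h
≈S-trans f≈g g≈h m = trans (f≈g m) (g≈h m)

≈S-setoid : Setoid 0ℓ 0ℓ
≈S-setoid = record
  { Carrier = Series
  ; _≈_ = _≈S_
  ; isEquivalence = record { refl = ≈S-refl ; sym = ≈S-sym ; trans = ≈S-trans }
  }

module SeriesReasoning = SetoidReasoning ≈S-setoid

-- shift k f = t^k · f  and  Δ k f = (1 - t^k) · f
shift : ℕ → Series → Series
shift k f m = if k ≤ᵇ m then f (m ∸ k) else + 0

Δ : ℕ → Series → Series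
Δ k f = f -S shift k f

Δ* : List ℕ → Series → Series
Δ* [] f = f
Δ* (k ∷ ks) f = Δ k (Δ* ks f)

shift-≤ : ∀ k f {m} → k ≤ m → shift k f m ≡ f (m ∸ k)
shift-≤ k f k≤m rewrite ≤ᵇ-true k≤m = refl

shift-> : ∀ k f {m} → m < k → shift k f m ≡ + 0
shift-> k f m<k rewrite ≤ᵇ-false m<k = refl

shift-cong : ∀ k {f g} → f ≈S g → shift k f ≈S shift k g
shift-cong k f≈g m with k ≤ᵇ m
... | true = f≈g (m ∸ k)
... | false = refl

Δ-cong : ∀ k {f g} → f ≈S g → Δ k f ≈S Δ k g
Δ-cong k f≈g m = cong₂ ℤ._-_ (f≈g m) (shift-cong k f≈g m)

Δ*-cong : ∀ ks {f g} → f ≈S g → Δ* ks f ≈S Δ* ks g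
Δ*-cong [] f≈g = f≈g
Δ*-cong (k ∷ ks) f≈g = Δ-cong k (Δ*-cong ks f≈g)

shift-shift : ∀ a b f → shift a (shift b f) ≈S shift (a + b) f
shift-shift a b f m with ℕₚ.≤-<-connex a m
... | inj₂ m<a = trans (shift-> a (shift b f) m<a) (sym (shift-> (a + b) f (ℕₚ.<-≤-trans m<a (ℕₚ.m≤m+n a b))))
... | inj₁ a≤m with ℕₚ.≤-<-connex b (m ∸ a)
...   | inj₁ b≤m∸a = begin
  shift a (shift b f) m  ≡⟨ shift-≤ a (shift b f) a≤m ⟩
  shift b f (m ∸ a)      ≡⟨ shift-≤ b f b≤m∸a ⟩
  f (m ∸ a ∸ b)          ≡⟨ cong f (ℕₚ.∸-+-assoc m a b) ⟩
  f (m ∸ (a + b))        ≡⟨ shift-≤ (a + b) f a+b≤m ⟨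
  shift (a + b) f m      ∎
  where
  open ≡-Reasoning
  a+b≤m = subst (a + b ≤_) (ℕₚ.m+[n∸m]≡n a≤m) (ℕₚ.+-monoʳ-≤ a b≤m∸a)
...   | inj₂ m∸a<b = trans (shift-≤ a (shift b f) a≤m) (trans (shift-> b f m∸a<b) (sym (shift-> (a + b) f m<a+b)))
  where
  m<a+b = subst (_< a + b) (ℕₚ.m+[n∸m]≡n a≤m) (ℕₚ.+-monoʳ-< a m∸a<b)

shift-comm : ∀ a b f → shift a (shift b f) ≈S shift b (shift a f)
shift-comm a b f m = trans (shift-shift a b f m)
  (trans (cong (λ c → shift c f m) (ℕₚ.+-comm a b)) (sym (shift-shift b a f m)))

shift-0S : ∀ k → shift k 0S ≈S 0S
shift-0S k m with k ≤ᵇ m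
... | true = refl
... | false = refl

shift-distrib-+ : ∀ k f g → shift k (f +S g) ≈S shift k f +S shift k g
shift-distrib-+ k f g m with k ≤ᵇ m
... | true = refl
... | false = refl

shift-distrib-- : ∀ k f g → shift k (f -S g) ≈S shift k f -S shift k g
shift-distrib-- k f g m with k ≤ᵇ m
... | true = refl
... | false = refl

shift-·S : ∀ k c f → shift k (c ·S f) ≈S c ·S shift k f
shift-·S k c f m with k ≤ᵇ m
... | true = refl
... | false = sym (ℤₚ.*-zeroʳ c)

Δ-zero : ∀ f → Δ 0 f ≈S 0S
Δ-zero f m = ℤₚ.+-inverseʳ (f m)

Δ-0S : ∀ k → Δ k 0S ≈S 0S
Δ-0S k m = cong (λ z → + 0 ℤ.- z) (shift-0S k m)

Δ-comm : ∀ a b f → Δ a (Δ b f) ≈S Δ b (Δ a f)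
Δ-comm a b f m = begin
  (f m ℤ.- shift b f m) ℤ.- shift a (Δ b f) m
    ≡⟨ cong (λ z → f m ℤ.- shift b f m ℤ.- z) (shift-distrib-- a f (shift b f) m) ⟩
  (f m ℤ.- shift b f m) ℤ.- (shift a f m ℤ.- shift a (shift b f) m)
    ≡⟨ cong (λ z → f m ℤ.- shift b f m ℤ.- (shift a f m ℤ.- z)) (shift-comm a b f m) ⟩
  (f m ℤ.- shift b f m) ℤ.- (shift a f m ℤ.- shift b (shift a f) m)
    ≡⟨ exchange (f m) (shift b f m) (shift a f m) (shift b (shift a f) m) ⟩
  (f m ℤ.- shift a f m) ℤ.- (shift b f m ℤ.- shift b (shift a f) m)
    ≡⟨ cong (λ z → f m ℤ.- shift a f m ℤ.- z) (shift-distrib-- b f (shift a f) m) ⟨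
  (f m ℤ.- shift a f m) ℤ.- shift b (Δ a f) m
    ∎
  where
  open ≡-Reasoning
  exchange : ∀ (x y z w : ℤ) → (x ℤ.- y) ℤ.- (z ℤ.- w) ≡ (x ℤ.- z) ℤ.- (y ℤ.- w)
  exchange = solve-∀

Δ-shift : ∀ a b f → Δ a (shift b f) ≈S shift b (Δ a f)
Δ-shift a b f m = trans (cong (λ z → shift b f m ℤ.- z) (shift-comm a b f m)) (sym (shift-distrib-- b f (shift a f) m))

Δ-distrib-+ : ∀ k f g → Δ k (f +S g) ≈S Δ k f +S Δ k g
Δ-distrib-+ k f g m = trans (cong (λ z → f m ℤ.+ g m ℤ.- z) (shift-distrib-+ k f g m))
  (interchange (f m) (g m) (shift k f m) (shift k g m))
  where
  interchange : ∀ (x y z w : ℤ) → (x ℤ.+ y) ℤ.- (z ℤ.+ w) ≡ (x ℤ.- z) ℤ.+ (y ℤ.- w)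
  interchange = solve-∀

Δ-·S : ∀ k c f → Δ k (c ·S f) ≈S c ·S Δ k f
Δ-·S k c f m = trans (cong (λ z → c ℤ.* f m ℤ.- z) (shift-·S k c f m)) (factor c (f m) (shift k f m))
  where
  factor : ∀ (c x y : ℤ) → c ℤ.* x ℤ.- c ℤ.* y ≡ c ℤ.* (x ℤ.- y)
  factor = solve-∀

Δ*-Δ : ∀ ks k f → Δ* ks (Δ k f) ≈S Δ k (Δ* ks f)
Δ*-Δ [] k f = ≈S-refl
Δ*-Δ (a ∷ ks) k f = ≈S-trans (Δ-cong a (Δ*-Δ ks k f)) (Δ-comm a k (Δ* ks f))

Δ*-comm : ∀ as bs f → Δ* as (Δ* bs f) ≈S Δ* bs (Δ* as f)
Δ*-comm [] bs f = ≈S-refl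
Δ*-comm (a ∷ as) bs f = ≈S-trans (Δ-cong a (Δ*-comm as bs f)) (≈S-sym (Δ*-Δ bs a (Δ* as f)))

Δ*-shift : ∀ ks k f → Δ* ks (shift k f) ≈S shift k (Δ* ks f)
Δ*-shift [] k f = ≈S-refl
Δ*-shift (a ∷ ks) k f = ≈S-trans (Δ-cong a (Δ*-shift ks k f)) (Δ-shift a k (Δ* ks f))

Δ*-distrib-+ : ∀ ks f g → Δ* ks (f +S g) ≈S Δ* ks f +S Δ* ks g
Δ*-distrib-+ [] f g = ≈S-refl
Δ*-distrib-+ (a ∷ ks) f g = ≈S-trans (Δ-cong a (Δ*-distrib-+ ks f g)) (Δ-distrib-+ a (Δ* ks f) (Δ* ks g))

Δ*-0S : ∀ ks → Δ* ks 0S ≈S 0S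
Δ*-0S [] = ≈S-refl
Δ*-0S (a ∷ ks) = ≈S-trans (Δ-cong a (Δ*-0S ks)) (Δ-0S a)

Δ*-++ : ∀ as bs f → Δ* (as ++ bs) f ≡ Δ* as (Δ* bs f)
Δ*-++ [] bs f = refl
Δ*-++ (a ∷ as) bs f = cong (Δ a) (Δ*-++ as bs f)

Δ*-↭ : ∀ {as bs} → as ↭ bs → ∀ f → Δ* as f ≈S Δ* bs f
Δ*-↭ ↭.refl f = ≈S-refl
Δ*-↭ (↭.prep a p) f = Δ-cong a (Δ*-↭ p f)
Δ*-↭ (↭.swap {ys = bs} a b p) f = ≈S-trans (Δ-cong a (Δ-cong b (Δ*-↭ p f))) (Δ-comm a b (Δ* bs f))
Δ*-↭ (↭.trans p q) f = ≈S-trans (Δ*-↭ p f) (Δ*-↭ q f)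

-- The coefficients of f are recovered from those of Δ k f by f m = Δ k f m + f (m - k).
Δ-injective : ∀ k → 0 < k → ∀ {f g} → Δ k f ≈S Δ k g → f ≈S g
Δ-injective k 0<k {f} {g} Δf≈Δg = <-rec _ step
  where
  restore : ∀ (x y : ℤ) → (x ℤ.- y) ℤ.+ y ≡ x
  restore = solve-∀
  step : ∀ m → (∀ {j} → j < m → f j ≡ g j) → f m ≡ g m
  step m ih with ℕₚ.≤-<-connex k m
  ... | inj₁ k≤m = begin
    f m                              ≡⟨ restore (f m) (shift k f m) ⟨
    Δ k f m ℤ.+ shift k f m          ≡⟨ cong₂ ℤ._+_ (Δf≈Δg m) shifted ⟩
    Δ k g m ℤ.+ shift k g m          ≡⟨ restore (g m) (shift k g m) ⟩
    g m                              ∎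
    where
    open ≡-Reasoning
    shifted : shift k f m ≡ shift k g m
    shifted = trans (shift-≤ k f k≤m) (trans (ih (ℕₚ.∸-monoʳ-< 0<k k≤m)) (sym (shift-≤ k g k≤m)))
  ... | inj₂ m<k = begin
    f m                   ≡⟨ ℤₚ.+-identityʳ (f m) ⟨
    f m ℤ.- + 0           ≡⟨ cong (λ z → f m ℤ.- z) (shift-> k f m<k) ⟨
    Δ k f m               ≡⟨ Δf≈Δg m ⟩
    g m ℤ.- shift k g m   ≡⟨ cong (λ z → g m ℤ.- z) (shift-> k g m<k) ⟩
    g m ℤ.- + 0           ≡⟨ ℤₚ.+-identityʳ (g m) ⟩
    g m                   ∎
    where open ≡-Reasoning

Δ*-injective : ∀ ks → All (0 <_) ks → ∀ {f g} → Δ* ks f ≈S Δ* ks g → f ≈S g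
Δ*-injective [] [] eq = eq
Δ*-injective (k ∷ ks) (0<k ∷ pos) eq = Δ*-injective ks pos (Δ-injective k 0<k eq)

sumTo-cong : ∀ m {F G : ℕ → ℤ} → (∀ i → i ≤ m → F i ≡ G i) → sumTo m F ≡ sumTo m G
sumTo-cong zero F≡G = F≡G 0 z≤n
sumTo-cong (suc m) F≡G =
  cong₂ ℤ._+_ (sumTo-cong m (λ i i≤m → F≡G i (ℕₚ.m≤n⇒m≤1+n i≤m))) (F≡G (suc m) ℕₚ.≤-refl)

sumTo-zero : ∀ m {F : ℕ → ℤ} → (∀ i → i ≤ m → F i ≡ + 0) → sumTo m F ≡ + 0
sumTo-zero zero F≡0 = F≡0 0 z≤n
sumTo-zero (suc m) F≡0 =
  cong₂ ℤ._+_ (sumTo-zero m (λ i i≤m → F≡0 i (ℕₚ.m≤n⇒m≤1+n i≤m))) (F≡0 (suc m) ℕₚ.≤-refl)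

sumTo-distrib-+ : ∀ m (F G : ℕ → ℤ) → sumTo m (λ i → F i ℤ.+ G i) ≡ sumTo m F ℤ.+ sumTo m G
sumTo-distrib-+ zero F G = refl
sumTo-distrib-+ (suc m) F G =
  trans (cong (ℤ._+ (F (suc m) ℤ.+ G (suc m))) (sumTo-distrib-+ m F G))
        (interchange (sumTo m F) (sumTo m G) (F (suc m)) (G (suc m)))
  where
  interchange : ∀ (a b c d : ℤ) → (a ℤ.+ b) ℤ.+ (c ℤ.+ d) ≡ (a ℤ.+ c) ℤ.+ (b ℤ.+ d)
  interchange = solve-∀

sumTo-distrib-- : ∀ m (F G : ℕ → ℤ) → sumTo m (λ i → F i ℤ.- G i) ≡ sumTo m F ℤ.- sumTo m G
sumTo-distrib-- zero F G = refl
sumTo-distrib-- (suc m) F G =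
  trans (cong (ℤ._+ (F (suc m) ℤ.- G (suc m))) (sumTo-distrib-- m F G))
        (interchange (sumTo m F) (sumTo m G) (F (suc m)) (G (suc m)))
  where
  interchange : ∀ (a b c d : ℤ) → (a ℤ.- b) ℤ.+ (c ℤ.- d) ≡ (a ℤ.+ c) ℤ.- (b ℤ.+ d)
  interchange = solve-∀

sumTo-unfoldˡ : ∀ m (F : ℕ → ℤ) → sumTo (suc m) F ≡ F 0 ℤ.+ sumTo m (λ i → F (suc i))
sumTo-unfoldˡ zero F = refl
sumTo-unfoldˡ (suc m) F = trans (cong (ℤ._+ F (suc (suc m))) (sumTo-unfoldˡ m F))
  (ℤₚ.+-assoc (F 0) (sumTo m (λ i → F (suc i))) (F (suc (suc m))))

sumTo-truncate : ∀ {p} m {F : ℕ → ℤ} → p ≤ m → (∀ i → p < i → i ≤ m → F i ≡ + 0) →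
                 sumTo m F ≡ sumTo p F
sumTo-truncate zero z≤n _ = refl
sumTo-truncate {p} (suc m) {F} p≤1+m vanish with ℕₚ.m≤n⇒m<n∨m≡n p≤1+m
... | inj₂ refl = refl
... | inj₁ (s≤s p≤m) = begin
  sumTo m F ℤ.+ F (suc m) ≡⟨ cong₂ ℤ._+_ (sumTo-truncate m p≤m vanish′) (vanish (suc m) (s≤s p≤m) ℕₚ.≤-refl) ⟩
  sumTo p F ℤ.+ + 0       ≡⟨ ℤₚ.+-identityʳ (sumTo p F) ⟩
  sumTo p F               ∎
  where
  open ≡-Reasoning
  vanish′ = λ i p<i i≤m → vanish i p<i (ℕₚ.m≤n⇒m≤1+n i≤m)

sumTo-reverse : ∀ m (F : ℕ → ℤ) → sumTo m F ≡ sumTo m (λ i → F (m ∸ i))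
sumTo-reverse zero F = refl
sumTo-reverse (suc m) F =
  trans (cong (ℤ._+ F (suc m)) (sumTo-reverse m F))
  (trans (ℤₚ.+-comm (sumTo m (λ i → F (m ∸ i))) (F (suc m)))
         (sym (sumTo-unfoldˡ m (λ i → F (suc m ∸ i)))))

δ-refl : ∀ j → δ j j ≡ + 1
δ-refl j rewrite ≡ᵇ-refl j = refl

δ-≢ : ∀ {i j} → ¬ i ≡ j → δ i j ≡ + 0
δ-≢ {i} {j} i≢j rewrite ≡ᵇ-false i≢j = refl

sumTo-δ : ∀ m j (G : ℕ → ℤ) → sumTo m (λ i → δ i j ℤ.* G i) ≡ (if j ≤ᵇ m then G j else + 0)
sumTo-δ zero zero G = ℤₚ.*-identityˡ (G 0)
sumTo-δ zero (suc j) G = refl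
sumTo-δ (suc m) j G with ℕₚ.<-cmp j (suc m)
... | tri< j<1+m _ _ = begin
  sumTo m (λ i → δ i j ℤ.* G i) ℤ.+ δ (suc m) j ℤ.* G (suc m)
    ≡⟨ cong₂ ℤ._+_ (sumTo-δ m j G) (cong (ℤ._* G (suc m)) (δ-≢ (λ e → ℕₚ.<-irrefl (sym e) j<1+m))) ⟩
  (if j ≤ᵇ m then G j else + 0) ℤ.+ + 0 ℤ.* G (suc m)
    ≡⟨ cong₂ (λ b z → (if b then G j else + 0) ℤ.+ z) (≤ᵇ-true (ℕₚ.≤-pred j<1+m)) (ℤₚ.*-zeroˡ (G (suc m))) ⟩
  G j ℤ.+ + 0
    ≡⟨ ℤₚ.+-identityʳ (G j) ⟩
  G j
    ≡⟨ cong (if_then G j else + 0) (≤ᵇ-true (ℕₚ.<⇒≤ j<1+m)) ⟨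
  (if j ≤ᵇ suc m then G j else + 0)
    ∎
  where open ≡-Reasoning
... | tri≈ _ refl _ = begin
  sumTo m (λ i → δ i (suc m) ℤ.* G i) ℤ.+ δ (suc m) (suc m) ℤ.* G (suc m)
    ≡⟨ cong₂ ℤ._+_ (sumTo-δ m (suc m) G) (cong (ℤ._* G (suc m)) (δ-refl (suc m))) ⟩
  (if suc m ≤ᵇ m then G (suc m) else + 0) ℤ.+ + 1 ℤ.* G (suc m)
    ≡⟨ cong₂ (λ b z → (if b then G (suc m) else + 0) ℤ.+ z) (≤ᵇ-false (ℕₚ.n<1+n m)) (ℤₚ.*-identityˡ (G (suc m))) ⟩
  + 0 ℤ.+ G (suc m)
    ≡⟨ ℤₚ.+-identityˡ (G (suc m)) ⟩
  G (suc m)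
    ≡⟨ cong (if_then G (suc m) else + 0) (≤ᵇ-true (ℕₚ.≤-refl {suc m})) ⟨
  (if suc m ≤ᵇ suc m then G (suc m) else + 0)
    ∎
  where open ≡-Reasoning
... | tri> _ _ 1+m<j = begin
  sumTo m (λ i → δ i j ℤ.* G i) ℤ.+ δ (suc m) j ℤ.* G (suc m)
    ≡⟨ cong₂ ℤ._+_ (sumTo-δ m j G) (cong (ℤ._* G (suc m)) (δ-≢ (λ e → ℕₚ.<-irrefl e 1+m<j))) ⟩
  (if j ≤ᵇ m then G j else + 0) ℤ.+ + 0 ℤ.* G (suc m)
    ≡⟨ cong₂ (λ b z → (if b then G j else + 0) ℤ.+ z) (≤ᵇ-false (ℕₚ.<-trans (ℕₚ.n<1+n m) 1+m<j)) (ℤₚ.*-zeroˡ (G (suc m))) ⟩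
  + 0
    ≡⟨ cong (if_then G j else + 0) (≤ᵇ-false 1+m<j) ⟨
  (if j ≤ᵇ suc m then G j else + 0)
    ∎
  where open ≡-Reasoning

⊛-cong : ∀ {f f′ g g′} → f ≈S f′ → g ≈S g′ → f ⊛ g ≈S f′ ⊛ g′
⊛-cong f≈f′ g≈g′ m = sumTo-cong m (λ i _ → cong₂ ℤ._*_ (f≈f′ i) (g≈g′ (m ∸ i)))

⊛-comm : ∀ f g → f ⊛ g ≈S g ⊛ f
⊛-comm f g m = trans (sumTo-reverse m _) (sumTo-cong m (λ i i≤m →
  trans (cong (λ j → f (m ∸ i) ℤ.* g j) (ℕₚ.m∸[m∸n]≡n i≤m)) (ℤₚ.*-comm (f (m ∸ i)) (g i))))

oneS-⊛ : ∀ f → oneS ⊛ f ≈S f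
oneS-⊛ f m = sumTo-δ m 0 (λ i → f (m ∸ i))

⊛-oneS : ∀ f → f ⊛ oneS ≈S f
⊛-oneS f = ≈S-trans (⊛-comm f oneS) (oneS-⊛ f)

⊛-distribˡ-- : ∀ f g h → f ⊛ (g -S h) ≈S f ⊛ g -S f ⊛ h
⊛-distribˡ-- f g h m =
  trans (sumTo-cong m (λ i _ → distrib (f i) (g (m ∸ i)) (h (m ∸ i)))) (sumTo-distrib-- m _ _)
  where
  distrib : ∀ (a b c : ℤ) → a ℤ.* (b ℤ.- c) ≡ a ℤ.* b ℤ.- a ℤ.* c
  distrib = solve-∀

oneMinusT-⊛ : ∀ k g → oneMinusT k ⊛ g ≈S Δ k g
oneMinusT-⊛ k g m = begin
  sumTo m (λ i → (δ i 0 ℤ.- δ i k) ℤ.* g (m ∸ i))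
    ≡⟨ sumTo-cong m (λ i _ → distrib (δ i 0) (δ i k) (g (m ∸ i))) ⟩
  sumTo m (λ i → δ i 0 ℤ.* g (m ∸ i) ℤ.- δ i k ℤ.* g (m ∸ i))
    ≡⟨ sumTo-distrib-- m _ _ ⟩
  sumTo m (λ i → δ i 0 ℤ.* g (m ∸ i)) ℤ.- sumTo m (λ i → δ i k ℤ.* g (m ∸ i))
    ≡⟨ cong₂ ℤ._-_ (sumTo-δ m 0 (λ i → g (m ∸ i))) (sumTo-δ m k (λ i → g (m ∸ i))) ⟩
  Δ k g m
    ∎
  where
  open ≡-Reasoning
  distrib : ∀ (a b c : ℤ) → (a ℤ.- b) ℤ.* c ≡ a ℤ.* c ℤ.- b ℤ.* c
  distrib = solve-∀

⊛-shift : ∀ k f g → f ⊛ shift k g ≈S shift k (f ⊛ g)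
⊛-shift k f g m with ℕₚ.≤-<-connex k m
... | inj₂ m<k = trans (sumTo-zero m (λ i _ → trans (cong (λ z → f i ℤ.* z) (shift-> k g (ℕₚ.≤-<-trans (ℕₚ.m∸n≤m m i) m<k)))
                                                    (ℤₚ.*-zeroʳ (f i))))
                       (sym (shift-> k (f ⊛ g) m<k))
... | inj₁ k≤m = begin
  sumTo m (λ i → f i ℤ.* shift k g (m ∸ i))
    ≡⟨ sumTo-truncate m (ℕₚ.m∸n≤m m k) (λ i m∸k<i i≤m → trans (cong (λ z → f i ℤ.* z) (shift-> k g (small i m∸k<i i≤m)))
                                                               (ℤₚ.*-zeroʳ (f i))) ⟩
  sumTo (m ∸ k) (λ i → f i ℤ.* shift k g (m ∸ i))
    ≡⟨ sumTo-cong (m ∸ k) (λ i i≤m∸k → cong (λ z → f i ℤ.* z) (trans (shift-≤ k g (large i i≤m∸k)) (cong g (swap∸ i)))) ⟩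
  (f ⊛ g) (m ∸ k)
    ≡⟨ shift-≤ k (f ⊛ g) k≤m ⟨
  shift k (f ⊛ g) m
    ∎
  where
  open ≡-Reasoning
  small : ∀ i → m ∸ k < i → i ≤ m → m ∸ i < k
  small i m∸k<i i≤m = ℕₚ.+-cancelʳ-< i (m ∸ i) k (subst (_< k + i) (sym (ℕₚ.m∸n+n≡m i≤m))
                        (ℕₚ.≤-<-trans (ℕₚ.m≤n+m∸n m k) (ℕₚ.+-monoʳ-< k m∸k<i)))
  large : ∀ i → i ≤ m ∸ k → k ≤ m ∸ i
  large i i≤m∸k = ℕₚ.m+n≤o⇒m≤o∸n k (subst (_≤ m) (ℕₚ.+-comm i k) (ℕₚ.m≤o∸n⇒m+n≤o i k≤m i≤m∸k))
  swap∸ : ∀ i → m ∸ i ∸ k ≡ m ∸ k ∸ i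
  swap∸ i = trans (ℕₚ.∸-+-assoc m i k) (trans (cong (m ∸_) (ℕₚ.+-comm i k)) (sym (ℕₚ.∸-+-assoc m k i)))

⊛-Δ : ∀ k f g → f ⊛ Δ k g ≈S Δ k (f ⊛ g)
⊛-Δ k f g = ≈S-trans (⊛-distribˡ-- f g (shift k g)) (λ m → cong (λ z → (f ⊛ g) m ℤ.- z) (⊛-shift k f g m))

⊛-Δ* : ∀ ks f g → f ⊛ Δ* ks g ≈S Δ* ks (f ⊛ g)
⊛-Δ* [] f g = ≈S-refl
⊛-Δ* (k ∷ ks) f g = ≈S-trans (⊛-Δ k f (Δ* ks g)) (Δ-cong k (⊛-Δ* ks f g))

Δ*-⊛ : ∀ ks f g → Δ* ks f ⊛ g ≈S Δ* ks (f ⊛ g)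
Δ*-⊛ ks f g = ≈S-trans (⊛-comm (Δ* ks f) g) (≈S-trans (⊛-Δ* ks g f) (Δ*-cong ks (⊛-comm g f)))

Δ*-++-⊛ : ∀ as bs f g → Δ* (as ++ bs) (f ⊛ g) ≈S Δ* as f ⊛ Δ* bs g
Δ*-++-⊛ as bs f g m = trans (cong (λ h → h m) (Δ*-++ as bs (f ⊛ g)))
  (sym (≈S-trans (Δ*-⊛ as f (Δ* bs g)) (Δ*-cong as (⊛-Δ* bs f g)) m))

prodS-oneMinusT : ∀ ks → prodS (map oneMinusT ks) ≈S Δ* ks oneS
prodS-oneMinusT [] = ≈S-refl
prodS-oneMinusT (k ∷ ks) = ≈S-trans (oneMinusT-⊛ k (prodS (map oneMinusT ks))) (Δ-cong k (prodS-oneMinusT ks))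

-- The series D_w and part (i)

+m-+n-≥ : ∀ {m n} → n ≤ m → + m ℤ.- + n ≡ + (m ∸ n)
+m-+n-≥ {m} {n} n≤m = trans (ℤₚ.m-n≡m⊖n m n) (ℤₚ.⊖-≥ n≤m)

+m-+n-< : ∀ {m n} → m < n → + m ℤ.- + n ≡ -[1+ n ∸ suc m ]
+m-+n-< {m} {n} m<n = trans (ℤₚ.m-n≡m⊖n m n) (⊖-< m<n)
  where
  ⊖-< : ∀ {m n} → m < n → m ⊖ n ≡ -[1+ n ∸ suc m ]
  ⊖-< {zero} {suc n} _ = refl
  ⊖-< {suc m} {suc n} (s≤s m<n) = trans (ℤₚ.[1+m]⊖[1+n]≡m⊖n m n) (⊖-< m<n)

sumℤ-map-++ : ∀ {A : Set} (h : A → ℤ) xs ys →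
              sumℤ (map h (xs ++ ys)) ≡ sumℤ (map h xs) ℤ.+ sumℤ (map h ys)
sumℤ-map-++ h [] ys = sym (ℤₚ.+-identityˡ _)
sumℤ-map-++ h (x ∷ xs) ys = trans (cong (λ z → h x ℤ.+ z) (sumℤ-map-++ h xs ys)) (sym (ℤₚ.+-assoc (h x) _ _))

sumℤ-map-cong : ∀ {A : Set} {h h′ : A → ℤ} xs → (∀ x → h x ≡ h′ x) → sumℤ (map h xs) ≡ sumℤ (map h′ xs)
sumℤ-map-cong [] h≡h′ = refl
sumℤ-map-cong (x ∷ xs) h≡h′ = cong₂ ℤ._+_ (h≡h′ x) (sumℤ-map-cong xs h≡h′)

sumℤ-map-neg : ∀ {A : Set} (h : A → ℤ) xs → sumℤ (map (λ x → ℤ.- h x) xs) ≡ ℤ.- sumℤ (map h xs)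
sumℤ-map-neg h [] = refl
sumℤ-map-neg h (x ∷ xs) = trans (cong (λ z → ℤ.- h x ℤ.+ z) (sumℤ-map-neg h xs)) (sym (ℤₚ.neg-distrib-+ (h x) _))

alternatingShifts : List ℕ → Series → Series
alternatingShifts ks f m = sumℤ (map (λ T → sgn (length T) ℤ.* shift (sum T) f m) (subsetsOf ks))

-- Expanding Π_{k ∈ ks} (1 - t^k) as a sum over subsets T ⊆ ks.
alternatingShifts≈Δ* : ∀ ks f → alternatingShifts ks f ≈S Δ* ks f
alternatingShifts≈Δ* [] f m = trans (ℤₚ.+-identityʳ _) (ℤₚ.*-identityˡ (f m))
alternatingShifts≈Δ* (k ∷ ks) f m = begin
  sumℤ (map term (subsetsOf ks ++ map (k ∷_) (subsetsOf ks)))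
    ≡⟨ sumℤ-map-++ term (subsetsOf ks) _ ⟩
  alternatingShifts ks f m ℤ.+ sumℤ (map term (map (k ∷_) (subsetsOf ks)))
    ≡⟨ cong (λ z → alternatingShifts ks f m ℤ.+ sumℤ z) (sym (Listₚ.map-∘ (subsetsOf ks))) ⟩
  alternatingShifts ks f m ℤ.+ sumℤ (map (λ T → term (k ∷ T)) (subsetsOf ks))
    ≡⟨ cong (λ z → alternatingShifts ks f m ℤ.+ z) (trans (sumℤ-map-cong (subsetsOf ks) term-cons) (sumℤ-map-neg _ (subsetsOf ks))) ⟩
  alternatingShifts ks f m ℤ.- alternatingShifts ks (shift k f) m
    ≡⟨ cong₂ ℤ._-_ (alternatingShifts≈Δ* ks f m) (alternatingShifts≈Δ* ks (shift k f) m) ⟩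
  Δ* ks f m ℤ.- Δ* ks (shift k f) m
    ≡⟨ cong (λ z → Δ* ks f m ℤ.- z) (Δ*-shift ks k f m) ⟩
  Δ* (k ∷ ks) f m
    ∎
  where
  open ≡-Reasoning
  term : List ℕ → ℤ
  term T = sgn (length T) ℤ.* shift (sum T) f m
  term-cons : ∀ T → term (k ∷ T) ≡ ℤ.- (sgn (length T) ℤ.* shift (sum T) (shift k f) m)
  term-cons T = trans (sym (ℤₚ.neg-distribˡ-* (sgn (length T)) _))
    (cong (λ z → ℤ.- (sgn (length T) ℤ.* z))
      (trans (cong (λ j → shift j f m) (ℕₚ.+-comm k (sum T))) (sym (shift-shift (sum T) k f m))))

Dseries : List ℕ → Series
Dseries w m = + D w m

Dℤ-shift : ∀ w m s → + Dℤ w (+ m ℤ.- + s) ≡ shift s (Dseries w) m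
Dℤ-shift w m s with ℕₚ.≤-<-connex s m
... | inj₁ s≤m = trans (cong (λ z → + Dℤ w z) (+m-+n-≥ s≤m)) (sym (shift-≤ s (Dseries w) s≤m))
... | inj₂ m<s = trans (cong (λ z → + Dℤ w z) (+m-+n-< m<s)) (sym (shift-> s (Dseries w) m<s))

sumToℕ-ℤ : ∀ m (F : ℕ → ℕ) → + sumToℕ m F ≡ sumTo m (λ i → + F i)
sumToℕ-ℤ zero F = refl
sumToℕ-ℤ (suc m) F = trans (ℤₚ.pos-+ (sumToℕ m F) (F (suc m))) (cong (ℤ._+ + F (suc m)) (sumToℕ-ℤ m F))

Dterm : List ℕ → ℕ → ℕ → ℕ → ℕ
Dterm ws w m i = if i * w ≤ᵇ m then D ws (m ∸ i * w) else 0

Dterm-vanish : ∀ ws {w m i} → 0 < w → m < i → Dterm ws w m i ≡ 0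
Dterm-vanish ws {w} {m} {i} 0<w m<i
  rewrite ≤ᵇ-false (ℕₚ.<-≤-trans m<i (ℕₚ.m≤m*n i w {{>-nonZero 0<w}})) = refl

Dterm-suc : ∀ ws {w m} i → w ≤ m → Dterm ws w m (suc i) ≡ Dterm ws w (m ∸ w) i
Dterm-suc ws {w} {m} i w≤m = cong₂ (λ b j → if b then D ws j else 0)
  (≤ᵇ-cong-⇔ (λ le → ℕₚ.m+n≤o⇒m≤o∸n (i * w) (subst (_≤ m) (ℕₚ.+-comm w (i * w)) le))
             (λ le → subst (_≤ m) (ℕₚ.+-comm (i * w) w) (ℕₚ.m≤o∸n⇒m+n≤o (i * w) w≤m le)))
  (sym (ℕₚ.∸-+-assoc m w (i * w)))

Dterm-suc-> : ∀ ws {w m} i → m < w → Dterm ws w m (suc i) ≡ 0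
Dterm-suc-> ws {w} {m} i m<w rewrite ≤ᵇ-false (ℕₚ.<-≤-trans m<w (ℕₚ.m≤m+n w (i * w))) = refl

Dseries-cons : ∀ {w} ws → 0 < w → Dseries (w ∷ ws) ≈S Dseries ws +S shift w (Dseries (w ∷ ws))
Dseries-cons {w} ws 0<w zero =
  trans (sym (ℤₚ.+-identityʳ _)) (cong (λ z → Dseries ws 0 ℤ.+ z) (sym (shift-> w (Dseries (w ∷ ws)) 0<w)))
Dseries-cons {w} ws 0<w (suc m) = begin
  + sumToℕ (suc m) (Dterm ws w (suc m))
    ≡⟨ sumToℕ-ℤ (suc m) (Dterm ws w (suc m)) ⟩
  sumTo (suc m) (λ i → + Dterm ws w (suc m) i)
    ≡⟨ sumTo-unfoldˡ m (λ i → + Dterm ws w (suc m) i) ⟩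
  Dseries ws (suc m) ℤ.+ sumTo m (λ i → + Dterm ws w (suc m) (suc i))
    ≡⟨ cong (λ z → Dseries ws (suc m) ℤ.+ z) tail ⟩
  Dseries ws (suc m) ℤ.+ shift w (Dseries (w ∷ ws)) (suc m)
    ∎
  where
  open ≡-Reasoning
  tail : sumTo m (λ i → + Dterm ws w (suc m) (suc i)) ≡ shift w (Dseries (w ∷ ws)) (suc m)
  tail with ℕₚ.≤-<-connex w (suc m)
  ... | inj₁ w≤1+m = begin
    sumTo m (λ i → + Dterm ws w (suc m) (suc i))
      ≡⟨ sumTo-cong m (λ i _ → cong +_ (Dterm-suc ws i w≤1+m)) ⟩
    sumTo m (λ i → + Dterm ws w (suc m ∸ w) i)
      ≡⟨ sumTo-truncate m (ℕₚ.≤-pred (ℕₚ.∸-monoʳ-< 0<w w≤1+m))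
                        (λ i lt _ → cong +_ (Dterm-vanish ws 0<w lt)) ⟩
    sumTo (suc m ∸ w) (λ i → + Dterm ws w (suc m ∸ w) i)
      ≡⟨ sumToℕ-ℤ (suc m ∸ w) (Dterm ws w (suc m ∸ w)) ⟨
    Dseries (w ∷ ws) (suc m ∸ w)
      ≡⟨ shift-≤ w (Dseries (w ∷ ws)) w≤1+m ⟨
    shift w (Dseries (w ∷ ws)) (suc m)
      ∎
  ... | inj₂ 1+m<w = trans (sumTo-zero m (λ i _ → cong +_ (Dterm-suc-> ws i 1+m<w)))
                           (sym (shift-> w (Dseries (w ∷ ws)) 1+m<w))

Δ-Dseries-cons : ∀ {w} ws → 0 < w → Δ w (Dseries (w ∷ ws)) ≈S Dseries ws
Δ-Dseries-cons {w} ws 0<w m =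
  trans (cong (λ z → z ℤ.- shift w (Dseries (w ∷ ws)) m) (Dseries-cons ws 0<w m))
        (cancel (Dseries ws m) (shift w (Dseries (w ∷ ws)) m))
  where
  cancel : ∀ (a b : ℤ) → (a ℤ.+ b) ℤ.- b ≡ a
  cancel = solve-∀

Dseries-[] : Dseries [] ≈S oneS
Dseries-[] zero = refl
Dseries-[] (suc m) = refl

Δ*-Dseries : ∀ ws → All (0 <_) ws → Δ* ws (Dseries ws) ≈S oneS
Δ*-Dseries [] [] = Dseries-[]
Δ*-Dseries (w ∷ ws) (0<w ∷ pos) =
  ≈S-trans (≈S-sym (Δ*-Δ ws w (Dseries (w ∷ ws))))
  (≈S-trans (Δ*-cong ws (Δ-Dseries-cons ws 0<w)) (Δ*-Dseries ws pos))

altSubsetSum-Dℤ : ∀ w r → (λ m → altSubsetSum r (λ s → + Dℤ w (+ m ℤ.- + s))) ≈S Δ* (oneTo r) (Dseries w)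
altSubsetSum-Dℤ w r m =
  trans (sumℤ-map-cong (subsetsOf (oneTo r)) (λ T → cong (λ z → sgn (length T) ℤ.* z) (Dℤ-shift w m (sum T))))
        (alternatingShifts≈Δ* (oneTo r) (Dseries w) m)

altSubsetSumD-⊛-prodS : (n : ℕ) → 0 < n → (w : Vec ℕ n) → All (λ x → 0 < x) (toList w) → (r : ℕ) →
  (λ m → altSubsetSum r (λ s → + Dℤ (toList w) (+ m ℤ.- + s)))
    ⊛ prodS (map oneMinusT (toList w))
    ≈S prodS (map oneMinusT (oneTo r))
altSubsetSumD-⊛-prodS _ _ w w>0 r = begin
  (λ m → altSubsetSum r (λ s → + Dℤ ws (+ m ℤ.- + s))) ⊛ prodS (map oneMinusT ws)
    ≈⟨ ⊛-cong (altSubsetSum-Dℤ ws r) (prodS-oneMinusT ws) ⟩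
  Δ* (oneTo r) (Dseries ws) ⊛ Δ* ws oneS
    ≈⟨ ⊛-Δ* ws (Δ* (oneTo r) (Dseries ws)) oneS ⟩
  Δ* ws (Δ* (oneTo r) (Dseries ws) ⊛ oneS)
    ≈⟨ Δ*-cong ws (⊛-oneS (Δ* (oneTo r) (Dseries ws))) ⟩
  Δ* ws (Δ* (oneTo r) (Dseries ws))
    ≈⟨ Δ*-comm ws (oneTo r) (Dseries ws) ⟩
  Δ* (oneTo r) (Δ* ws (Dseries ws))
    ≈⟨ Δ*-cong (oneTo r) (Δ*-Dseries ws w>0) ⟩
  Δ* (oneTo r) oneS
    ≈⟨ prodS-oneMinusT (oneTo r) ⟨
  prodS (map oneMinusT (oneTo r))
    ∎
  where
  ws = toList w
  open SeriesReasoning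

sumFin : (a : ℕ) → (Fin a → ℕ) → ℕ
sumFin zero F = 0
sumFin (suc a) F = F zero + sumFin a (λ i → F (suc i))

andFin : (a : ℕ) → (Fin a → Bool) → Bool
andFin zero F = true
andFin (suc a) F = F zero ∧ andFin a (λ i → F (suc i))

sumFin-cong : ∀ a {F G : Fin a → ℕ} → (∀ i → F i ≡ G i) → sumFin a F ≡ sumFin a G
sumFin-cong zero F≡G = refl
sumFin-cong (suc a) F≡G = cong₂ _+_ (F≡G zero) (sumFin-cong a (λ i → F≡G (suc i)))

sumFin-zero : ∀ a {F : Fin a → ℕ} → (∀ i → F i ≡ 0) → sumFin a F ≡ 0
sumFin-zero zero F≡0 = refl
sumFin-zero (suc a) F≡0 = cong₂ _+_ (F≡0 zero) (sumFin-zero a (λ i → F≡0 (suc i)))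

sumFin-distrib-+ : ∀ a (F G : Fin a → ℕ) → sumFin a (λ i → F i + G i) ≡ sumFin a F + sumFin a G
sumFin-distrib-+ zero F G = refl
sumFin-distrib-+ (suc a) F G = trans (cong (λ z → F zero + G zero + z) (sumFin-distrib-+ a _ _))
  (interchange (F zero) (G zero) (sumFin a (λ i → F (suc i))) (sumFin a (λ i → G (suc i))))
  where
  interchange : ∀ a b c d → a + b + (c + d) ≡ a + c + (b + d)
  interchange = ℕ-Solver.solve-∀

sumFin-≥ : ∀ a (F : Fin a → ℕ) x → F x ≤ sumFin a F
sumFin-≥ (suc a) F zero = ℕₚ.m≤m+n (F zero) _
sumFin-≥ (suc a) F (suc x) = ℕₚ.≤-trans (sumFin-≥ a (λ i → F (suc i)) x) (ℕₚ.m≤n+m _ (F zero))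

andFin-true⁻ : ∀ a {F : Fin a → Bool} → andFin a F ≡ true → ∀ i → F i ≡ true
andFin-true⁻ (suc a) {F} eq zero with F zero | eq
... | true | _ = refl
andFin-true⁻ (suc a) {F} eq (suc i) with F zero | eq
... | true | eq′ = andFin-true⁻ a eq′ i

andFin-true : ∀ a {F : Fin a → Bool} → (∀ i → F i ≡ true) → andFin a F ≡ true
andFin-true zero F≡true = refl
andFin-true (suc a) F≡true rewrite F≡true zero = andFin-true a (λ i → F≡true (suc i))

allB-tabulate : ∀ {A : Set} (p : A → Bool) {b} (h : Fin b → A) → allB p (tabulate h) ≡ andFin b (λ i → p (h i))
allB-tabulate p {zero} h = refl
allB-tabulate p {suc b} h = cong (p (h zero) ∧_) (allB-tabulate p (λ i → h (suc i)))

countB-++ : ∀ {A : Set} (p : A → Bool) xs ys → countB p (xs ++ ys) ≡ countB p xs + countB p ys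
countB-++ p [] ys = refl
countB-++ p (x ∷ xs) ys = trans (cong (λ z → (if p x then 1 else 0) + z) (countB-++ p xs ys))
  (sym (ℕₚ.+-assoc (if p x then 1 else 0) _ _))

countB-concatMap-tabulate : ∀ {A : Set} {a b} (p : A → Bool) (f : Fin a → List A) (h : Fin b → Fin a) →
  countB p (concatMap f (tabulate h)) ≡ sumFin b (λ x → countB p (f (h x)))
countB-concatMap-tabulate {b = zero} p f h = refl
countB-concatMap-tabulate {b = suc b} p f h = trans (countB-++ p (f (h zero)) _)
  (cong (λ z → countB p (f (h zero)) + z) (countB-concatMap-tabulate p f (λ i → h (suc i))))

countB-map : ∀ {A B : Set} (p : B → Bool) (f : A → B) xs → countB p (map f xs) ≡ countB (λ x → p (f x)) xs
countB-map p f [] = refl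
countB-map p f (x ∷ xs) = cong (λ z → (if p (f x) then 1 else 0) + z) (countB-map p f xs)

countB-cong : ∀ {A : Set} {p q : A → Bool} xs → (∀ x → p x ≡ q x) → countB p xs ≡ countB q xs
countB-cong [] p≡q = refl
countB-cong (x ∷ xs) p≡q = cong₂ (λ b z → (if b then 1 else 0) + z) (p≡q x) (countB-cong xs p≡q)

countB-∧ : ∀ {A : Set} (b : Bool) (q : A → Bool) xs → countB (λ x → b ∧ q x) xs ≡ (if b then countB q xs else 0)
countB-∧ true q xs = refl
countB-∧ false q [] = refl
countB-∧ false q (x ∷ xs) = countB-∧ false q xs

wordCount : (a n : ℕ) → Vec ℕ a → ℕ → ℕ
wordCount a n c k = countB (λ v → allB (λ i → occ i v ≡ᵇ lookup c i) (allFin a) ∧ (inv v ≡ᵇ k)) (allWords a n)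

countBelow : ∀ {a} → Vec ℕ a → Fin a → ℕ
countBelow (c₀ ∷ c) zero = 0
countBelow (c₀ ∷ c) (suc x) = c₀ + countBelow c x

decrementAt : ∀ {a} → Vec ℕ a → Fin a → Vec ℕ a
decrementAt (c₀ ∷ c) zero = (c₀ ∸ 1) ∷ c
decrementAt (c₀ ∷ c) (suc x) = c₀ ∷ decrementAt c x

countBelow-decrementAt : ∀ {a} (c : Vec ℕ a) x → countBelow (decrementAt c x) x ≡ countBelow c x
countBelow-decrementAt (c₀ ∷ c) zero = refl
countBelow-decrementAt (c₀ ∷ c) (suc x) = cong (λ z → c₀ + z) (countBelow-decrementAt c x)

sum-decrementAt : ∀ {a} (c : Vec ℕ a) x → 1 ≤ lookup c x → suc (sum (toList (decrementAt c x))) ≡ sum (toList c)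
sum-decrementAt (suc c₀ ∷ c) zero _ = refl
sum-decrementAt (c₀ ∷ c) (suc x) 1≤cₓ = trans (sym (ℕₚ.+-suc c₀ _)) (cong (λ z → c₀ + z) (sum-decrementAt c x 1≤cₓ))

countBelow≡sumFin : ∀ {a} (c : Vec ℕ a) x → countBelow c x ≡ sumFin a (λ i → if toℕ i <ᵇ toℕ x then lookup c i else 0)
countBelow≡sumFin {suc a} (c₀ ∷ c) zero = sym (sumFin-zero a (λ i → refl))
countBelow≡sumFin {suc a} (c₀ ∷ c) (suc x) = cong (λ z → c₀ + z) (countBelow≡sumFin c x)

isLetter : ∀ {a} → Fin a → Fin a → ℕ
isLetter i x = if toℕ i ≡ᵇ toℕ x then 1 else 0

sumFin-isLetter-below : ∀ a (y : Fin a) t →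
  sumFin a (λ i → if toℕ i <ᵇ t then isLetter i y else 0) ≡ (if toℕ y <ᵇ t then 1 else 0)
sumFin-isLetter-below (suc a) zero t =
  trans (cong (λ z → (if 0 <ᵇ t then 1 else 0) + z) (sumFin-zero a (λ i → Boolₚ.if-eta (suc (toℕ i) <ᵇ t))))
        (ℕₚ.+-identityʳ _)
sumFin-isLetter-below (suc a) (suc y) zero = sumFin-zero a (λ i → refl)
sumFin-isLetter-below (suc a) (suc y) (suc t) =
  trans (cong (_+ sumFin a (λ i → if suc (toℕ i) <ᵇ suc t then isLetter (suc i) (suc y) else 0))
              (Boolₚ.if-eta (0 <ᵇ suc t)))
        (sumFin-isLetter-below a y t)

smallerAfter≡sumFin : ∀ {a n} (x : Fin a) (v : Vec (Fin a) n) →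
  smallerAfter x v ≡ sumFin a (λ i → if toℕ i <ᵇ toℕ x then occ i v else 0)
smallerAfter≡sumFin {a} x [] = sym (sumFin-zero a (λ i → Boolₚ.if-eta _))
smallerAfter≡sumFin {a} x (y ∷ ys) = sym (begin
  sumFin a (λ i → if toℕ i <ᵇ toℕ x then isLetter i y + occ i ys else 0)
    ≡⟨ sumFin-cong a (λ i → if-distrib-+ (toℕ i <ᵇ toℕ x) (isLetter i y) (occ i ys)) ⟩
  sumFin a (λ i → (if toℕ i <ᵇ toℕ x then isLetter i y else 0) + (if toℕ i <ᵇ toℕ x then occ i ys else 0))
    ≡⟨ sumFin-distrib-+ a (λ i → if toℕ i <ᵇ toℕ x then isLetter i y else 0) (λ i → if toℕ i <ᵇ toℕ x then occ i ys else 0) ⟩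
  sumFin a (λ i → if toℕ i <ᵇ toℕ x then isLetter i y else 0) + sumFin a (λ i → if toℕ i <ᵇ toℕ x then occ i ys else 0)
    ≡⟨ cong₂ _+_ (sumFin-isLetter-below a y (toℕ x)) (sym (smallerAfter≡sumFin x ys)) ⟩
  smallerAfter x (y ∷ ys)
    ∎)
  where open ≡-Reasoning

occurrences-cons : ∀ a (o : Fin a → ℕ) (c : Vec ℕ a) (x : Fin a) →
  andFin a (λ i → isLetter i x + o i ≡ᵇ lookup c i)
    ≡ (1 ≤ᵇ lookup c x) ∧ andFin a (λ i → o i ≡ᵇ lookup (decrementAt c x) i)
occurrences-cons (suc a) o (c₀ ∷ c) zero =
  trans (cong (_∧ andFin a (λ i → o (suc i) ≡ᵇ lookup c i)) (suc-≡ᵇ (o zero) c₀))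
        (Boolₚ.∧-assoc (1 ≤ᵇ c₀) (o zero ≡ᵇ c₀ ∸ 1) _)
occurrences-cons (suc a) o (c₀ ∷ c) (suc x) =
  trans (cong ((o zero ≡ᵇ c₀) ∧_) (occurrences-cons a (λ i → o (suc i)) c x))
        (∧-exchangeˡ (o zero ≡ᵇ c₀) (1 ≤ᵇ lookup c x) _)

hasContentAndInversions : (a : ℕ) → Vec ℕ a → ℕ → ∀ {n} → Vec (Fin a) n → Bool
hasContentAndInversions a c k v = allB (λ i → occ i v ≡ᵇ lookup c i) (allFin a) ∧ (inv v ≡ᵇ k)

-- The first letter x of a word forms an inversion with exactly the countBelow c x later letters.
hasContentAndInversions-cons : ∀ a c k {n} (x : Fin a) (v : Vec (Fin a) n) →
  hasContentAndInversions a c k (x ∷ v)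
    ≡ ((1 ≤ᵇ lookup c x) ∧ (countBelow c x ≤ᵇ k)) ∧ hasContentAndInversions a (decrementAt c x) (k ∸ countBelow c x) v
hasContentAndInversions-cons a c k x v
  rewrite allB-tabulate (λ i → occ i (x ∷ v) ≡ᵇ lookup c i) {a} (λ i → i)
        | allB-tabulate (λ i → occ i v ≡ᵇ lookup (decrementAt c x) i) {a} (λ i → i)
        | occurrences-cons a (λ i → occ i v) c x
  with andFin a (λ i → occ i v ≡ᵇ lookup (decrementAt c x) i) in content
... | false = falseBoth (1 ≤ᵇ lookup c x) (countBelow c x ≤ᵇ k) {s = inv v ≡ᵇ k ∸ countBelow c x}
  where
  falseBoth : ∀ p q {r s} → (p ∧ false) ∧ r ≡ (p ∧ q) ∧ (false ∧ s)
  falseBoth true true = refl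
  falseBoth true false = refl
  falseBoth false q = refl
... | true = begin
  ((1 ≤ᵇ lookup c x) ∧ true) ∧ (smallerAfter x v + inv v ≡ᵇ k)
    ≡⟨ cong (λ s → ((1 ≤ᵇ lookup c x) ∧ true) ∧ (s + inv v ≡ᵇ k)) smallerAfter≡countBelow ⟩
  ((1 ≤ᵇ lookup c x) ∧ true) ∧ (countBelow c x + inv v ≡ᵇ k)
    ≡⟨ cong (((1 ≤ᵇ lookup c x) ∧ true) ∧_) (+-≡ᵇ (countBelow c x) (inv v) k) ⟩
  ((1 ≤ᵇ lookup c x) ∧ true) ∧ ((countBelow c x ≤ᵇ k) ∧ (inv v ≡ᵇ k ∸ countBelow c x))
    ≡⟨ regroup (1 ≤ᵇ lookup c x) (countBelow c x ≤ᵇ k) ⟩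
  ((1 ≤ᵇ lookup c x) ∧ (countBelow c x ≤ᵇ k)) ∧ (true ∧ (inv v ≡ᵇ k ∸ countBelow c x))
    ∎
  where
  open ≡-Reasoning
  regroup : ∀ p q {r} → (p ∧ true) ∧ (q ∧ r) ≡ (p ∧ q) ∧ (true ∧ r)
  regroup true q = refl
  regroup false q = refl
  occ≡ : ∀ i → occ i v ≡ lookup (decrementAt c x) i
  occ≡ i = ℕₚ.≡ᵇ⇒≡ _ _ (Equivalence.from Boolₚ.T-≡ (andFin-true⁻ a content i))
  smallerAfter≡countBelow : smallerAfter x v ≡ countBelow c x
  smallerAfter≡countBelow = begin
    smallerAfter x v
      ≡⟨ smallerAfter≡sumFin x v ⟩
    sumFin a (λ i → if toℕ i <ᵇ toℕ x then occ i v else 0)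
      ≡⟨ sumFin-cong a (λ i → cong (if toℕ i <ᵇ toℕ x then_else 0) (occ≡ i)) ⟩
    sumFin a (λ i → if toℕ i <ᵇ toℕ x then lookup (decrementAt c x) i else 0)
      ≡⟨ countBelow≡sumFin (decrementAt c x) x ⟨
    countBelow (decrementAt c x) x
      ≡⟨ countBelow-decrementAt c x ⟩
    countBelow c x
      ∎

wordCount-suc : ∀ a n c k → wordCount a (suc n) c k ≡
  sumFin a (λ x → if (1 ≤ᵇ lookup c x) ∧ (countBelow c x ≤ᵇ k)
                  then wordCount a n (decrementAt c x) (k ∸ countBelow c x) else 0)
wordCount-suc a n c k =
  trans (countB-concatMap-tabulate (hasContentAndInversions a c k) (λ x → map (x ∷_) (allWords a n)) (λ x → x))
  (sumFin-cong a (λ x → trans (countB-map (hasContentAndInversions a c k) (x ∷_) (allWords a n))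
    (trans (countB-cong (allWords a n) (hasContentAndInversions-cons a c k x))
           (countB-∧ _ (hasContentAndInversions a (decrementAt c x) (k ∸ countBelow c x)) (allWords a n)))))

-- The q-multinomial theorem

wordSeries : (a n : ℕ) → Vec ℕ a → Series
wordSeries a n c k = + wordCount a n c k

sumSeries : (a : ℕ) → (Fin a → Series) → Series
sumSeries zero F = 0S
sumSeries (suc a) F = F zero +S sumSeries a (λ i → F (suc i))

sumSeries-cong : ∀ a {F G : Fin a → Series} → (∀ i → F i ≈S G i) → sumSeries a F ≈S sumSeries a G
sumSeries-cong zero F≈G m = refl
sumSeries-cong (suc a) F≈G m = cong₂ ℤ._+_ (F≈G zero m) (sumSeries-cong a (λ i → F≈G (suc i)) m)

Δ*-sumSeries : ∀ ks a (F : Fin a → Series) → Δ* ks (sumSeries a F) ≈S sumSeries a (λ x → Δ* ks (F x))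
Δ*-sumSeries ks zero F = Δ*-0S ks
Δ*-sumSeries ks (suc a) F = ≈S-trans (Δ*-distrib-+ ks (F zero) (sumSeries a (λ i → F (suc i))))
  (λ m → cong (λ z → Δ* ks (F zero) m ℤ.+ z) (Δ*-sumSeries ks a (λ i → F (suc i)) m))

shift-sumSeries : ∀ k a (F : Fin a → Series) → shift k (sumSeries a F) ≈S sumSeries a (λ x → shift k (F x))
shift-sumSeries k zero F = shift-0S k
shift-sumSeries k (suc a) F = ≈S-trans (shift-distrib-+ k (F zero) (sumSeries a (λ i → F (suc i))))
  (λ m → cong (λ z → shift k (F zero) m ℤ.+ z) (shift-sumSeries k a (λ i → F (suc i)) m))

+-sumFin : ∀ a (F : Fin a → ℕ) m → + sumFin a F ≡ sumSeries a (λ x _ → + F x) m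
+-sumFin zero F m = refl
+-sumFin (suc a) F m = trans (ℤₚ.pos-+ (F zero) _) (cong (λ z → + F zero ℤ.+ z) (+-sumFin a (λ i → F (suc i)) m))

sumSeries-apply : ∀ a (F : Fin a → Series) m → sumSeries a F m ≡ sumSeries a (λ x _ → F x m) m
sumSeries-apply zero F m = refl
sumSeries-apply (suc a) F m = cong (λ z → F zero m ℤ.+ z) (sumSeries-apply a (λ i → F (suc i)) m)

firstLetterTerm : (a n : ℕ) → Vec ℕ a → Fin a → Series
firstLetterTerm a n c x = if 1 ≤ᵇ lookup c x then shift (countBelow c x) (wordSeries a n (decrementAt c x)) else 0S

wordSeries-suc : ∀ a n c → wordSeries a (suc n) c ≈S sumSeries a (firstLetterTerm a n c)
wordSeries-suc a n c k = begin
  + wordCount a (suc n) c k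
    ≡⟨ cong +_ (wordCount-suc a n c k) ⟩
  + sumFin a _
    ≡⟨ +-sumFin a _ k ⟩
  sumSeries a _ k
    ≡⟨ sumSeries-cong a {G = λ x _ → firstLetterTerm a n c x k} (λ x _ → term x) k ⟩
  sumSeries a (λ x _ → firstLetterTerm a n c x k) k
    ≡⟨ sumSeries-apply a (firstLetterTerm a n c) k ⟨
  sumSeries a (firstLetterTerm a n c) k
    ∎
  where
  open ≡-Reasoning
  term : ∀ x → + (if (1 ≤ᵇ lookup c x) ∧ (countBelow c x ≤ᵇ k)
                  then wordCount a n (decrementAt c x) (k ∸ countBelow c x) else 0)
               ≡ firstLetterTerm a n c x k
  term x with 1 ≤ᵇ lookup c x
  ... | false = refl
  ... | true with countBelow c x ≤ᵇ k
  ...   | true = refl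
  ...   | false = refl

sum≡0⇒lookup≡0 : ∀ {a} (c : Vec ℕ a) → sum (toList c) ≡ 0 → ∀ i → lookup c i ≡ 0
sum≡0⇒lookup≡0 (c₀ ∷ c) Σc≡0 zero = ℕₚ.m+n≡0⇒m≡0 c₀ Σc≡0
sum≡0⇒lookup≡0 (c₀ ∷ c) Σc≡0 (suc i) = sum≡0⇒lookup≡0 c (ℕₚ.m+n≡0⇒n≡0 c₀ Σc≡0) i

wordSeries-zero : ∀ a c → sum (toList c) ≡ 0 → wordSeries a 0 c ≈S oneS
wordSeries-zero a c Σc≡0 k
  rewrite allB-tabulate (λ i → 0 ≡ᵇ lookup c i) {a} (λ i → i)
        | andFin-true a {λ i → 0 ≡ᵇ lookup c i} (λ i → cong (0 ≡ᵇ_) (sum≡0⇒lookup≡0 c Σc≡0 i))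
  with k
... | zero = refl
... | suc _ = refl

oneTo-suc : ∀ m → oneTo (suc m) ≡ oneTo m ∷ʳ suc m
oneTo-suc m = trans (cong (map suc) (sym (Listₚ.upTo-∷ʳ m))) (Listₚ.map-++ suc (upTo m) (m ∷ []))

oneTo-suc-↭ : ∀ m → oneTo (suc m) ↭ suc m ∷ oneTo m
oneTo-suc-↭ m = ↭-trans (↭.↭-reflexive (oneTo-suc m)) (↭-sym (↭ₚ.∷↭∷ʳ (suc m) (oneTo m)))

oneTo-positive : ∀ m → All (0 <_) (oneTo m)
oneTo-positive m = Allₚ.map⁺ (All.universal (λ _ → s≤s z≤n) (upTo m))

map-oneTo-cong : ∀ {A : Set} m {f g : ℕ → A} → (∀ j → 1 ≤ j → j ≤ m → f j ≡ g j) → map f (oneTo m) ≡ map g (oneTo m)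
map-oneTo-cong m f≡g =
  Listₚ.map-cong-local (Allₚ.map⁺ (Allₚ.applyUpTo⁺₁ _ m (λ {i} i<m → f≡g (suc i) (s≤s z≤n) i<m)))

oneTo-+ : ∀ a b → oneTo (a + b) ≡ oneTo a ++ map (_+_ a) (oneTo b)
oneTo-+ a zero = trans (cong oneTo (ℕₚ.+-identityʳ a)) (sym (Listₚ.++-identityʳ (oneTo a)))
oneTo-+ a (suc b) = begin
  oneTo (a + suc b)                                   ≡⟨ cong oneTo (ℕₚ.+-suc a b) ⟩
  oneTo (suc (a + b))                                 ≡⟨ oneTo-suc (a + b) ⟩
  oneTo (a + b) ∷ʳ suc (a + b)                        ≡⟨ cong (_∷ʳ suc (a + b)) (oneTo-+ a b) ⟩
  (oneTo a ++ map (_+_ a) (oneTo b)) ∷ʳ suc (a + b)    ≡⟨ Listₚ.++-assoc (oneTo a) _ _ ⟩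
  oneTo a ++ (map (_+_ a) (oneTo b) ∷ʳ suc (a + b))    ≡⟨ cong (λ z → oneTo a ++ (map (_+_ a) (oneTo b) ∷ʳ z)) (ℕₚ.+-suc a b) ⟨
  oneTo a ++ (map (_+_ a) (oneTo b) ∷ʳ (a + suc b))    ≡⟨ cong (oneTo a ++_) (Listₚ.map-++ (_+_ a) (oneTo b) (suc b ∷ [])) ⟨
  oneTo a ++ map (_+_ a) (oneTo b ∷ʳ suc b)            ≡⟨ cong (λ z → oneTo a ++ map (_+_ a) z) (oneTo-suc b) ⟨
  oneTo a ++ map (_+_ a) (oneTo (suc b))               ∎
  where open ≡-Reasoning

length-oneTo : ∀ m → length (oneTo m) ≡ m
length-oneTo m = trans (Listₚ.length-map suc (upTo m)) (Listₚ.length-upTo m)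

-- The exponents j of the factors (1 - t^j) of Π_i [c_i]_t! · (1 - t)^(c_1 + ⋯ + c_a).
factorialFactors : ∀ {a} → Vec ℕ a → List ℕ
factorialFactors c = concatMap oneTo (toList c)

factorialFactors-positive : ∀ {a} (c : Vec ℕ a) → All (0 <_) (factorialFactors c)
factorialFactors-positive [] = []
factorialFactors-positive (c₀ ∷ c) = Allₚ.++⁺ (oneTo-positive c₀) (factorialFactors-positive c)

factorialFactors-decrementAt : ∀ {a} (c : Vec ℕ a) x → 1 ≤ lookup c x →
  factorialFactors c ↭ lookup c x ∷ factorialFactors (decrementAt c x)
factorialFactors-decrementAt (suc c₀ ∷ c) zero _ = ↭ₚ.++⁺ʳ (factorialFactors c) (oneTo-suc-↭ c₀)
factorialFactors-decrementAt (c₀ ∷ c) (suc x) 1≤cₓ =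
  ↭-trans (↭ₚ.++⁺ˡ (oneTo c₀) (factorialFactors-decrementAt c x 1≤cₓ))
          (↭ₚ.shift (lookup c x) (oneTo c₀) (factorialFactors (decrementAt c x)))

factorialFactors-zero : ∀ {a} (c : Vec ℕ a) → sum (toList c) ≡ 0 → factorialFactors c ≡ []
factorialFactors-zero [] _ = refl
factorialFactors-zero (zero ∷ c) Σc≡0 = factorialFactors-zero c Σc≡0

sumSeries-telescope : ∀ {a} (c : Vec ℕ a) g →
  sumSeries a (λ x → shift (countBelow c x) (Δ (lookup c x) g)) ≈S Δ (sum (toList c)) g
sumSeries-telescope [] g = ≈S-sym (Δ-zero g)
sumSeries-telescope {suc a} (c₀ ∷ c) g m = begin
  Δ c₀ g m ℤ.+ sumSeries a (λ x → shift (c₀ + countBelow c x) (Δ (lookup c x) g)) m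
    ≡⟨ cong (λ z → Δ c₀ g m ℤ.+ z) (sumSeries-cong a (λ x → ≈S-sym (shift-shift c₀ (countBelow c x) (Δ (lookup c x) g))) m) ⟩
  Δ c₀ g m ℤ.+ sumSeries a (λ x → shift c₀ (shift (countBelow c x) (Δ (lookup c x) g))) m
    ≡⟨ cong (λ z → Δ c₀ g m ℤ.+ z) (shift-sumSeries c₀ a (λ x → shift (countBelow c x) (Δ (lookup c x) g)) m) ⟨
  Δ c₀ g m ℤ.+ shift c₀ (sumSeries a (λ x → shift (countBelow c x) (Δ (lookup c x) g))) m
    ≡⟨ cong (λ z → Δ c₀ g m ℤ.+ z) (shift-cong c₀ (sumSeries-telescope c g) m) ⟩
  Δ c₀ g m ℤ.+ shift c₀ (Δ (sum (toList c)) g) m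
    ≡⟨ cong (λ z → Δ c₀ g m ℤ.+ z) (shift-distrib-- c₀ g (shift (sum (toList c)) g) m) ⟩
  Δ c₀ g m ℤ.+ (shift c₀ g m ℤ.- shift c₀ (shift (sum (toList c)) g) m)
    ≡⟨ cong (λ z → Δ c₀ g m ℤ.+ (shift c₀ g m ℤ.- z)) (shift-shift c₀ (sum (toList c)) g m) ⟩
  (g m ℤ.- shift c₀ g m) ℤ.+ (shift c₀ g m ℤ.- shift (c₀ + sum (toList c)) g m)
    ≡⟨ collapse (g m) (shift c₀ g m) (shift (c₀ + sum (toList c)) g m) ⟩
  Δ (c₀ + sum (toList c)) g m
    ∎
  where
  open ≡-Reasoning
  collapse : ∀ (x y z : ℤ) → (x ℤ.- y) ℤ.+ (y ℤ.- z) ≡ x ℤ.- z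
  collapse = solve-∀

-- The q-multinomial theorem, cleared of denominators.
Δ*-wordSeries : ∀ n a (c : Vec ℕ a) → sum (toList c) ≡ n →
  Δ* (factorialFactors c) (wordSeries a n c) ≈S Δ* (oneTo n) oneS
Δ*-wordSeries zero a c Σc≡0 =
  ≈S-trans (Δ*-cong (factorialFactors c) (wordSeries-zero a c Σc≡0))
           (λ m → cong (λ ks → Δ* ks oneS m) (factorialFactors-zero c Σc≡0))
Δ*-wordSeries (suc n) a c Σc≡1+n = begin
  Δ* ks (wordSeries a (suc n) c)
    ≈⟨ Δ*-cong ks (wordSeries-suc a n c) ⟩
  Δ* ks (sumSeries a (firstLetterTerm a n c))
    ≈⟨ Δ*-sumSeries ks a (firstLetterTerm a n c) ⟩
  sumSeries a (λ x → Δ* ks (firstLetterTerm a n c x))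
    ≈⟨ sumSeries-cong a term ⟩
  sumSeries a (λ x → shift (countBelow c x) (Δ (lookup c x) G))
    ≈⟨ sumSeries-telescope c G ⟩
  Δ (sum (toList c)) G
    ≈⟨ (λ m → cong (λ j → Δ j G m) Σc≡1+n) ⟩
  Δ (suc n) G
    ≈⟨ Δ*-↭ (oneTo-suc-↭ n) oneS ⟨
  Δ* (oneTo (suc n)) oneS
    ∎
  where
  open SeriesReasoning
  ks = factorialFactors c
  G = Δ* (oneTo n) oneS
  term : ∀ x → Δ* ks (firstLetterTerm a n c x) ≈S shift (countBelow c x) (Δ (lookup c x) G)
  term x with lookup c x in cₓ≡
  ... | zero = ≈S-trans (Δ*-0S ks)
                        (≈S-sym (≈S-trans (shift-cong (countBelow c x) (Δ-zero G)) (shift-0S (countBelow c x))))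
  ... | suc q = begin
    Δ* ks (shift (countBelow c x) (wordSeries a n c-x))
      ≈⟨ Δ*-shift ks (countBelow c x) (wordSeries a n c-x) ⟩
    shift (countBelow c x) (Δ* ks (wordSeries a n c-x))
      ≈⟨ shift-cong (countBelow c x) (Δ*-↭ (factorialFactors-decrementAt c x 1≤cₓ) (wordSeries a n c-x)) ⟩
    shift (countBelow c x) (Δ (lookup c x) (Δ* (factorialFactors c-x) (wordSeries a n c-x)))
      ≈⟨ shift-cong (countBelow c x) (λ m → cong (λ j → Δ j (Δ* (factorialFactors c-x) (wordSeries a n c-x)) m) cₓ≡) ⟩
    shift (countBelow c x) (Δ (suc q) (Δ* (factorialFactors c-x) (wordSeries a n c-x)))
      ≈⟨ shift-cong (countBelow c x) (Δ-cong (suc q) (Δ*-wordSeries n a c-x Σc-x≡n)) ⟩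
    shift (countBelow c x) (Δ (suc q) G)
      ∎
    where
    c-x = decrementAt c x
    1≤cₓ : 1 ≤ lookup c x
    1≤cₓ = subst (1 ≤_) (sym cₓ≡) (s≤s z≤n)
    Σc-x≡n : sum (toList c-x) ≡ n
    Σc-x≡n = ℕₚ.suc-injective (trans (sum-decrementAt c x 1≤cₓ) Σc≡1+n)

-- The sequence ε(d, n) and parts (ii), (iii)

below-none : ∀ i xs → All (i ≤_) xs → below i xs ≡ 0
below-none i [] [] = refl
below-none i (y ∷ ys) (i≤y ∷ i≤ys) rewrite <ᵇ-false i≤y = below-none i ys i≤ys

below-cons : ∀ i x xs → x < i → below i (x ∷ xs) ≡ x ⊔ below i xs
below-cons i x xs x<i rewrite <ᵇ-true x<i = refl

Linked⇒All-head : ∀ {x xs} → Linked _<_ (x ∷ xs) → All (x <_) xs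
Linked⇒All-head [-] = []
Linked⇒All-head (x<y ∷ rest) = Linkedₚ.Linked⇒All ℕₚ.<-trans x<y rest

∸-split : ∀ {p x n} → p ≤ x → x ≤ n → (x ∸ p) + (n ∸ x) ≡ n ∸ p
∸-split {p} {x} {n} p≤x x≤n = trans (ℕₚ.+-comm (x ∸ p) (n ∸ x))
  (trans (sym (ℕₚ.+-∸-assoc (n ∸ x) p≤x)) (cong (_∸ p) (ℕₚ.m∸n+n≡m x≤n)))

cutWeight : ℕ → List ℕ → ℕ → ℕ
cutWeight p d i = i ∸ (p ⊔ below i d)

cutWeight-[] : ∀ p j → cutWeight p [] (p + j) ≡ j
cutWeight-[] p j = trans (cong (λ z → p + j ∸ z) (ℕₚ.⊔-identityʳ p)) (ℕₚ.m+n∸m≡n p j)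

cutWeight-before : ∀ {p x xs j} → p ≤ x → All (x <_) xs → j ≤ x ∸ p → cutWeight p (x ∷ xs) (p + j) ≡ j
cutWeight-before {p} {x} {xs} {j} p≤x x<xs j≤x∸p =
  trans (cong (λ z → p + j ∸ (p ⊔ z)) (below-none (p + j) (x ∷ xs) (p+j≤x ∷ All.map (ℕₚ.≤-trans p+j≤x ∘ ℕₚ.<⇒≤) x<xs)))
        (cutWeight-[] p j)
  where
  p+j≤x = subst (p + j ≤_) (ℕₚ.m+[n∸m]≡n p≤x) (ℕₚ.+-monoʳ-≤ p j≤x∸p)

cutWeight-after : ∀ {p x xs j} → p ≤ x → 1 ≤ j → cutWeight p (x ∷ xs) (p + ((x ∸ p) + j)) ≡ cutWeight x xs (x + j)
cutWeight-after {p} {x} {xs} {j} p≤x 1≤j = begin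
  p + ((x ∸ p) + j) ∸ (p ⊔ below (p + ((x ∸ p) + j)) (x ∷ xs))
    ≡⟨ cong (λ i → i ∸ (p ⊔ below i (x ∷ xs))) position ⟩
  x + j ∸ (p ⊔ below (x + j) (x ∷ xs))
    ≡⟨ cong (λ z → x + j ∸ (p ⊔ z)) (below-cons (x + j) x xs x<x+j) ⟩
  x + j ∸ (p ⊔ (x ⊔ below (x + j) xs))
    ≡⟨ cong (λ z → x + j ∸ z) (ℕₚ.⊔-assoc p x _) ⟨
  x + j ∸ (p ⊔ x ⊔ below (x + j) xs)
    ≡⟨ cong (λ z → x + j ∸ (z ⊔ below (x + j) xs)) (ℕₚ.m≤n⇒m⊔n≡n p≤x) ⟩
  x + j ∸ (x ⊔ below (x + j) xs)
    ∎
  where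
  open ≡-Reasoning
  position : p + ((x ∸ p) + j) ≡ x + j
  position = trans (sym (ℕₚ.+-assoc p (x ∸ p) j)) (cong (_+ j) (ℕₚ.m+[n∸m]≡n p≤x))
  x<x+j : x < x + j
  x<x+j = subst (_≤ x + j) (ℕₚ.+-comm x 1) (ℕₚ.+-monoʳ-≤ x 1≤j)

-- Positions p+1, …, n of ε(d, n) split into the blocks between consecutive cut points,
-- and on a block of length e the weights run through 1, …, e.
cutWeights≡factorialFactors : ∀ d p n → Linked _<_ d → All (p <_) d → All (_≤ n) d → p ≤ n →
  map (λ j → cutWeight p d (p + j)) (oneTo (n ∸ p)) ≡ factorialFactors (gaps p d n)
cutWeights≡factorialFactors [] p n _ _ _ _ =
  trans (map-oneTo-cong (n ∸ p) (λ j _ _ → cutWeight-[] p j))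
  (trans (Listₚ.map-id (oneTo (n ∸ p))) (sym (Listₚ.++-identityʳ (oneTo (n ∸ p)))))
cutWeights≡factorialFactors (x ∷ xs) p n linked (p<x ∷ _) (x≤n ∷ xs≤n) _ = begin
  map w (oneTo (n ∸ p))
    ≡⟨ cong (map w) (trans (cong oneTo (sym (∸-split p≤x x≤n))) (oneTo-+ (x ∸ p) (n ∸ x))) ⟩
  map w (oneTo (x ∸ p) ++ map (_+_ (x ∸ p)) (oneTo (n ∸ x)))
    ≡⟨ Listₚ.map-++ w (oneTo (x ∸ p)) _ ⟩
  map w (oneTo (x ∸ p)) ++ map w (map (_+_ (x ∸ p)) (oneTo (n ∸ x)))
    ≡⟨ cong₂ _++_ first (sym (Listₚ.map-∘ (oneTo (n ∸ x)))) ⟩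
  oneTo (x ∸ p) ++ map (λ j → w ((x ∸ p) + j)) (oneTo (n ∸ x))
    ≡⟨ cong (oneTo (x ∸ p) ++_) (map-oneTo-cong (n ∸ x) (λ j 1≤j _ → cutWeight-after {xs = xs} p≤x 1≤j)) ⟩
  oneTo (x ∸ p) ++ map (λ j → cutWeight x xs (x + j)) (oneTo (n ∸ x))
    ≡⟨ cong (oneTo (x ∸ p) ++_) (cutWeights≡factorialFactors xs x n (Linked.tail linked) x<xs xs≤n x≤n) ⟩
  oneTo (x ∸ p) ++ factorialFactors (gaps x xs n)
    ∎
  where
  open ≡-Reasoning
  w = λ j → cutWeight p (x ∷ xs) (p + j)
  p≤x = ℕₚ.<⇒≤ p<x
  x<xs = Linked⇒All-head linked
  first : map w (oneTo (x ∸ p)) ≡ oneTo (x ∸ p)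
  first = trans (map-oneTo-cong (x ∸ p) (λ j _ j≤x∸p → cutWeight-before p≤x x<xs j≤x∸p)) (Listₚ.map-id (oneTo (x ∸ p)))

ε≡factorialFactors : ∀ n d → Valid n d → ε d n ≡ factorialFactors (gaps 0 d n)
ε≡factorialFactors n d (linked , positive , bounded) =
  cutWeights≡factorialFactors d 0 n linked positive (All.map ℕₚ.<⇒≤ bounded) z≤n

sum-gaps-from : ∀ d p n → Linked _<_ d → All (p <_) d → All (_≤ n) d → p ≤ n → sum (toList (gaps p d n)) ≡ n ∸ p
sum-gaps-from [] p n _ _ _ _ = ℕₚ.+-identityʳ (n ∸ p)
sum-gaps-from (x ∷ xs) p n linked (p<x ∷ _) (x≤n ∷ xs≤n) _ =
  trans (cong (_+_ (x ∸ p)) (sum-gaps-from xs x n (Linked.tail linked) (Linked⇒All-head linked) xs≤n x≤n))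
        (∸-split (ℕₚ.<⇒≤ p<x) x≤n)

sum-gaps : ∀ n d → Valid n d → sum (toList (gaps 0 d n)) ≡ n
sum-gaps n d (linked , positive , bounded) = sum-gaps-from d 0 n linked positive (All.map ℕₚ.<⇒≤ bounded) z≤n

-- Both sides become Π_{j ≤ n} (1 - t^j) after multiplying by Π_{j ∈ ε(d,n)} (1 - t^j).
wordSeries≈Δ*-Dseries : ∀ n d → Valid n d →
  wordSeries (suc (length d)) n (gaps 0 d n) ≈S Δ* (oneTo n) (Dseries (ε d n))
wordSeries≈Δ*-Dseries n d valid = Δ*-injective ks (factorialFactors-positive c) (begin
  Δ* ks (wordSeries (suc (length d)) n c)
    ≈⟨ Δ*-wordSeries n (suc (length d)) c (sum-gaps n d valid) ⟩
  Δ* (oneTo n) oneS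
    ≈⟨ Δ*-cong (oneTo n) (Δ*-Dseries ks (factorialFactors-positive c)) ⟨
  Δ* (oneTo n) (Δ* ks (Dseries ks))
    ≈⟨ (λ m → cong (λ w → Δ* (oneTo n) (Δ* ks (Dseries w)) m) (ε≡factorialFactors n d valid)) ⟨
  Δ* (oneTo n) (Δ* ks (Dseries (ε d n)))
    ≈⟨ Δ*-comm (oneTo n) ks (Dseries (ε d n)) ⟩
  Δ* ks (Δ* (oneTo n) (Dseries (ε d n)))
    ∎)
  where
  open SeriesReasoning
  c = gaps 0 d n
  ks = factorialFactors c

-- Grouping the subsets T by ω(T) = i; the terms with i > k vanish.
altSubsetSum≡ψ-sum : ∀ k n (h : ℕ → ℤ) → (∀ s → k < s → h s ≡ + 0) →
  altSubsetSum n h ≡ sumTo k (λ i → ψ n i ℤ.* h i)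
altSubsetSum≡ψ-sum k n h h-vanish = go (subsetsOf (oneTo n))
  where
  indicator : List ℕ → ℕ → ℤ
  indicator T i = if sum T ≡ᵇ i then sgn (length T) else + 0
  single : ∀ T → sgn (length T) ℤ.* h (sum T) ≡ sumTo k (λ i → indicator T i ℤ.* h i)
  single T = sym (trans (sumTo-cong k (λ i _ → as-δ i)) (trans (sumTo-δ k (sum T) (λ i → σ ℤ.* h i)) in-range))
    where
    σ = sgn (length T)
    as-δ : ∀ i → indicator T i ℤ.* h i ≡ δ i (sum T) ℤ.* (σ ℤ.* h i)
    as-δ i rewrite ≡ᵇ-sym (sum T) i with i ≡ᵇ sum T
    ... | true = sym (ℤₚ.*-identityˡ _)
    ... | false = refl
    in-range : (if sum T ≤ᵇ k then σ ℤ.* h (sum T) else + 0) ≡ σ ℤ.* h (sum T)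
    in-range with ℕₚ.≤-<-connex (sum T) k
    ... | inj₁ ωT≤k rewrite ≤ᵇ-true ωT≤k = refl
    ... | inj₂ k<ωT rewrite ≤ᵇ-false k<ωT | h-vanish (sum T) k<ωT = sym (ℤₚ.*-zeroʳ σ)
  go : ∀ Ts → sumℤ (map (λ T → sgn (length T) ℤ.* h (sum T)) Ts)
              ≡ sumTo k (λ i → sumℤ (map (λ T → indicator T i) Ts) ℤ.* h i)
  go [] = sym (sumTo-zero k (λ i _ → refl))
  go (T ∷ Ts) =
    trans (cong₂ ℤ._+_ (single T) (go Ts))
    (trans (sym (sumTo-distrib-+ k _ _))
           (sumTo-cong k (λ i _ → sym (ℤₚ.*-distribʳ-+ (h i) (indicator T i) _))))

I≡altSubsetSumD : (n : ℕ) → 0 < n → (d : List ℕ) → Valid n d → (k : ℕ) →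
  (+ I n d k ≡ altSubsetSum n (λ s → + Dℤ (ε d n) (+ k ℤ.- + s)))
  × (+ I n d k ≡ sumTo k (λ i → ψ n i ℤ.* + Dℤ (ε d n) (+ k ℤ.- + i)))
I≡altSubsetSumD n _ d valid k =
  I≡alt , trans I≡alt (altSubsetSum≡ψ-sum k n (λ s → + Dℤ (ε d n) (+ k ℤ.- + s)) vanish)
  where
  I≡alt : + I n d k ≡ altSubsetSum n (λ s → + Dℤ (ε d n) (+ k ℤ.- + s))
  I≡alt = trans (wordSeries≈Δ*-Dseries n d valid k) (sym (altSubsetSum-Dℤ (ε d n) n k))
  vanish : ∀ s → k < s → + Dℤ (ε d n) (+ k ℤ.- + s) ≡ + 0
  vanish s k<s = trans (Dℤ-shift (ε d n) k s) (shift-> s (Dseries (ε d n)) k<s)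

D-1∷-suc : ∀ ws m → D (1 ∷ ws) (suc m) ≡ D ws (suc m) + D (1 ∷ ws) m
D-1∷-suc ws m = ℤₚ.+-injective (trans (Dseries-cons ws (s≤s z≤n) (suc m)) (sym (ℤₚ.pos-+ (D ws (suc m)) _)))

D-1∷-zero : ∀ ws → D (1 ∷ ws) 0 ≡ D ws 0
D-1∷-zero ws = ℤₚ.+-injective (trans (Dseries-cons {1} ws (s≤s z≤n) 0) (ℤₚ.+-identityʳ (+ D ws 0)))

D-ones : ∀ N m → D (replicate (suc N) 1) m ≡ (N + m) C N
D-ones zero zero = refl
D-ones zero (suc m) = trans (D-1∷-suc [] m) (D-ones zero m)
D-ones (suc N) zero = begin
  D (replicate (suc (suc N)) 1) 0   ≡⟨ D-1∷-zero (replicate (suc N) 1) ⟩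
  D (replicate (suc N) 1) 0         ≡⟨ D-ones N 0 ⟩
  (N + 0) C N                       ≡⟨ cong (_C N) (ℕₚ.+-identityʳ N) ⟩
  N C N                             ≡⟨ trans (nCn≡1 N) (sym (nCn≡1 (suc N))) ⟩
  suc N C suc N                     ≡⟨ cong (_C suc N) (ℕₚ.+-identityʳ (suc N)) ⟨
  (suc N + 0) C suc N               ∎
  where open ≡-Reasoning
D-ones (suc N) (suc m) = begin
  D (replicate (suc (suc N)) 1) (suc m)                    ≡⟨ D-1∷-suc (replicate (suc N) 1) m ⟩
  D (replicate (suc N) 1) (suc m) + D (replicate (suc (suc N)) 1) m
                                                           ≡⟨ cong₂ _+_ (D-ones N (suc m)) (D-ones (suc N) m) ⟩
  (N + suc m) C N + (suc N + m) C suc N                    ≡⟨ cong (λ z → z C N + suc (N + m) C suc N) (ℕₚ.+-suc N m) ⟩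
  suc (N + m) C N + suc (N + m) C suc N                    ≡⟨ nCk+nC[k+1]≡[n+1]C[k+1] (suc (N + m)) N ⟩
  suc (suc (N + m)) C suc N                                ≡⟨ cong (λ z → suc z C suc N) (ℕₚ.+-suc N m) ⟨
  (suc N + suc m) C suc N                                  ∎
  where open ≡-Reasoning

Dℤ-ones≡binomℤ : ∀ N k s → + Dℤ (replicate (suc N) 1) (+ k ℤ.- + s) ≡ + binomℤ (+ (N + k) ℤ.- + s) N
Dℤ-ones≡binomℤ N k s with ℕₚ.≤-<-connex s k
... | inj₁ s≤k = begin
  + Dℤ (replicate (suc N) 1) (+ k ℤ.- + s)    ≡⟨ cong (λ z → + Dℤ (replicate (suc N) 1) z) (+m-+n-≥ s≤k) ⟩
  + D (replicate (suc N) 1) (k ∸ s)           ≡⟨ cong +_ (D-ones N (k ∸ s)) ⟩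
  + ((N + (k ∸ s)) C N)                        ≡⟨ cong (λ z → + (z C N)) (ℕₚ.+-∸-assoc N s≤k) ⟨
  + ((N + k ∸ s) C N)                          ≡⟨ cong (λ z → + binomℤ z N) (+m-+n-≥ (ℕₚ.≤-trans s≤k (ℕₚ.m≤n+m k N))) ⟨
  + binomℤ (+ (N + k) ℤ.- + s) N               ∎
  where open ≡-Reasoning
... | inj₂ k<s = trans (cong (λ z → + Dℤ (replicate (suc N) 1) z) (+m-+n-< k<s)) (cong +_ (sym binom≡0))
  where
  binom≡0 : binomℤ (+ (N + k) ℤ.- + s) N ≡ 0
  binom≡0 with ℕₚ.≤-<-connex s (N + k)
  ... | inj₁ s≤N+k rewrite +m-+n-≥ s≤N+k = k>n⇒nCk≡0 N+k∸s<N
    where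
    N+k∸s<N : N + k ∸ s < N
    N+k∸s<N = ℕₚ.+-cancelʳ-< s (N + k ∸ s) N
                (subst (_< N + s) (sym (ℕₚ.m∸n+n≡m s≤N+k)) (ℕₚ.+-monoʳ-< N k<s))
  ... | inj₂ N+k<s rewrite +m-+n-< N+k<s = refl

oneTo-suc-shift : ∀ p N → map (_+_ p) (oneTo (suc N)) ≡ suc p ∷ map (_+_ (suc p)) (oneTo N)
oneTo-suc-shift p N = cong₂ _∷_ (ℕₚ.+-comm p 1) (begin
  map (_+_ p) (map suc (applyUpTo suc N))   ≡⟨ cong (λ is → map (_+_ p) (map suc is)) (Listₚ.map-upTo suc N) ⟨
  map (_+_ p) (map suc (oneTo N))           ≡⟨ Listₚ.map-∘ (oneTo N) ⟨
  map (λ j → p + suc j) (oneTo N)           ≡⟨ map-oneTo-cong N (λ j _ _ → ℕₚ.+-suc p j) ⟩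
  map (_+_ (suc p)) (oneTo N)               ∎)
  where open ≡-Reasoning

gaps-consecutive : ∀ N p → toList (gaps p (map (_+_ p) (oneTo N)) (p + suc N)) ≡ replicate (suc N) 1
gaps-consecutive zero p = cong (_∷ []) (ℕₚ.m+n∸m≡n p 1)
gaps-consecutive (suc N) p =
  trans (cong (λ ds → toList (gaps p ds (p + suc (suc N)))) (oneTo-suc-shift p N))
        (cong₂ _∷_ (ℕₚ.m+n∸n≡m 1 p)
                   (trans (cong (λ n → toList (gaps (suc p) (map (_+_ (suc p)) (oneTo N)) n)) (ℕₚ.+-suc p (suc N)))
                          (gaps-consecutive N (suc p))))

valid-permutation : ∀ N → Valid (suc N) (oneTo N)
valid-permutation N =
  Linkedₚ.map⁺ (Linkedₚ.applyUpTo⁺₂ (λ x → x) N (λ i → s≤s ℕₚ.≤-refl)) ,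
  oneTo-positive N ,
  Allₚ.map⁺ (Allₚ.applyUpTo⁺₁ (λ x → x) N (λ i<N → s≤s i<N))

factorialFactors-ones : ∀ n → concatMap oneTo (replicate n 1) ≡ replicate n 1
factorialFactors-ones zero = refl
factorialFactors-ones (suc n) = cong (1 ∷_) (factorialFactors-ones n)

ε-permutation : ∀ N → ε (oneTo N) (suc N) ≡ replicate (suc N) 1
ε-permutation N = begin
  ε (oneTo N) (suc N)                                 ≡⟨ ε≡factorialFactors (suc N) (oneTo N) (valid-permutation N) ⟩
  concatMap oneTo (toList (gaps 0 (oneTo N) (suc N))) ≡⟨ cong (λ ds → concatMap oneTo (toList (gaps 0 ds (suc N)))) (Listₚ.map-id (oneTo N)) ⟨
  concatMap oneTo (toList (gaps 0 (map (_+_ 0) (oneTo N)) (suc N)))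
                                                      ≡⟨ cong (concatMap oneTo) (gaps-consecutive N 0) ⟩
  concatMap oneTo (replicate (suc N) 1)               ≡⟨ factorialFactors-ones (suc N) ⟩
  replicate (suc N) 1                                 ∎
  where open ≡-Reasoning

Iperm≡altSubsetSumBinom : (n : ℕ) → 0 < n → (k : ℕ) →
  (+ Iperm n k ≡ altSubsetSum n (λ s → + binomℤ (+ (n ∸ 1 + k) ℤ.- + s) (n ∸ 1)))
  × (+ Iperm n k ≡ sumTo k (λ i → ψ n i ℤ.* + binomℤ (+ (n ∸ 1 + k) ℤ.- + i) (n ∸ 1)))
Iperm≡altSubsetSumBinom (suc N) 0<n k with I≡altSubsetSumD (suc N) 0<n (oneTo N) (valid-permutation N) k
... | I≡alt , I≡ψ =
  trans I≡alt (sumℤ-map-cong (subsetsOf (oneTo (suc N))) (λ T → cong (sgn (length T) ℤ.*_) (D≡binom (sum T)))) ,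
  trans I≡ψ (sumTo-cong k (λ i _ → cong (ψ (suc N) i ℤ.*_) (D≡binom i)))
  where
  D≡binom : ∀ s → + Dℤ (ε (oneTo N) (suc N)) (+ k ℤ.- + s) ≡ + binomℤ (+ (N + k) ℤ.- + s) N
  D≡binom s = trans (cong (λ w → + Dℤ w (+ k ℤ.- + s)) (ε-permutation N)) (Dℤ-ones≡binomℤ N k s)

-- Refinements and part (iv)

filterB-all-true : ∀ {A : Set} (q : A → Bool) xs → All (λ y → q y ≡ true) xs → filterB q xs ≡ xs
filterB-all-true q [] [] = refl
filterB-all-true q (y ∷ ys) (qy ∷ qys) rewrite qy = cong (y ∷_) (filterB-all-true q ys qys)

filterB-all-false : ∀ {A : Set} (q : A → Bool) xs → All (λ y → q y ≡ false) xs → filterB q xs ≡ []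
filterB-all-false q [] [] = refl
filterB-all-false q (y ∷ ys) (¬qy ∷ ¬qys) rewrite ¬qy = filterB-all-false q ys ¬qys

filterB-cong-local : ∀ {A : Set} (q q′ : A → Bool) xs → All (λ y → q y ≡ q′ y) xs → filterB q xs ≡ filterB q′ xs
filterB-cong-local q q′ [] [] = refl
filterB-cong-local q q′ (y ∷ ys) (qy≡q′y ∷ rest) rewrite qy≡q′y with q′ y
... | true = cong (y ∷_) (filterB-cong-local q q′ ys rest)
... | false = filterB-cong-local q q′ ys rest

filterB-satisfies : ∀ {A : Set} (q : A → Bool) xs → All (λ y → q y ≡ true) (filterB q xs)
filterB-satisfies q [] = []
filterB-satisfies q (y ∷ ys) with q y in qy
... | true = qy ∷ filterB-satisfies q ys
... | false = filterB-satisfies q ys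

filterB-All : ∀ {A : Set} {P : A → Set} (q : A → Bool) xs → All P xs → All P (filterB q xs)
filterB-All q [] [] = []
filterB-All q (y ∷ ys) (py ∷ pys) with q y
... | true = py ∷ filterB-All q ys pys
... | false = filterB-All q ys pys

filterB-Linked : ∀ (q : ℕ → Bool) xs → Linked _<_ xs → Linked _<_ (filterB q xs)
filterB-Linked q xs linked = Linkedₚ.AllPairs⇒Linked (go xs (Linkedₚ.Linked⇒AllPairs ℕₚ.<-trans linked))
  where
  go : ∀ xs → AllPairs _<_ xs → AllPairs _<_ (filterB q xs)
  go [] [] = []
  go (y ∷ ys) (y<ys ∷ rest) with q y
  ... | true = filterB-All q ys y<ys ∷ go ys rest
  ... | false = go ys rest

between : ℕ → ℕ → ℕ → Bool
between lo hi y = (lo <ᵇ y) ∧ (y <ᵇ hi)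

within : ℕ → ℕ → List ℕ → List ℕ
within lo hi = filterB (between lo hi)

between-false : ∀ p x {z} → x ≤ z → between p x z ≡ false
between-false p x x≤z rewrite <ᵇ-false x≤z = Boolₚ.∧-zeroʳ _

filterB-above-split : ∀ p x xs → p < x → Linked _<_ xs → x ∈ xs →
  filterB (p <ᵇ_) xs ≡ within p x xs ++ x ∷ filterB (x <ᵇ_) xs
filterB-above-split p x (x ∷ ys) p<x linked (here refl)
  rewrite <ᵇ-true p<x | <ᵇ-false {x} {x} ℕₚ.≤-refl
        | filterB-all-false (between p x) ys (All.map (λ x<z → between-false p x (ℕₚ.<⇒≤ x<z)) (Linked⇒All-head linked))
        | filterB-all-true (p <ᵇ_) ys (All.map (λ x<z → <ᵇ-true (ℕₚ.<-trans p<x x<z)) (Linked⇒All-head linked))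
        | filterB-all-true (x <ᵇ_) ys (All.map <ᵇ-true (Linked⇒All-head linked)) = refl
filterB-above-split p x (y ∷ ys) p<x linked (there x∈ys)
  rewrite <ᵇ-true (All.lookup (Linked⇒All-head linked) x∈ys)
        | <ᵇ-false {x} {y} (ℕₚ.<⇒≤ (All.lookup (Linked⇒All-head linked) x∈ys))
  with p <ᵇ y
... | true = cong (y ∷_) (filterB-above-split p x ys p<x (Linked.tail linked) x∈ys)
... | false = filterB-above-split p x ys p<x (Linked.tail linked) x∈ys

gaps-++ : ∀ p xs x ys n → toList (gaps p (xs ++ x ∷ ys) n) ≡ toList (gaps p xs x) ++ toList (gaps x ys n)
gaps-++ p [] x ys n = refl
gaps-++ p (y ∷ xs) x ys n = cong ((y ∸ p) ∷_) (gaps-++ y xs x ys n)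

gaps-∸ : ∀ xs q p n → p ≤ q → All (p ≤_) xs → toList (gaps q xs n) ≡ toList (gaps (q ∸ p) (map (_∸ p) xs) (n ∸ p))
gaps-∸ [] q p n p≤q [] = cong (_∷ []) (sym (∸-∸-∸ n p≤q))
  where
  ∸-∸-∸ : ∀ a {p q} → p ≤ q → (a ∸ p) ∸ (q ∸ p) ≡ a ∸ q
  ∸-∸-∸ a {p} {q} p≤q = trans (ℕₚ.∸-+-assoc a p (q ∸ p)) (cong (a ∸_) (ℕₚ.m+[n∸m]≡n p≤q))
gaps-∸ (x ∷ xs) q p n p≤q (p≤x ∷ p≤xs) =
  cong₂ _∷_ (sym (trans (ℕₚ.∸-+-assoc x p (q ∸ p)) (cong (x ∸_) (ℕₚ.m+[n∸m]≡n p≤q)))) (gaps-∸ xs x p n p≤x p≤xs)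

gapsWithin : List ℕ → ℕ × ℕ → List ℕ
gapsWithin xs (lo , hi) = toList (gaps lo (within lo hi xs) hi)

gaps-above≡concatMap-gapsWithin : ∀ n d p xs → Linked _<_ xs → All (_< n) xs →
  Linked _<_ d → All (p <_) d → All (_∈ xs) d →
  toList (gaps p (filterB (p <ᵇ_) xs) n) ≡ concatMap (gapsWithin xs) (blocks p d n)
gaps-above≡concatMap-gapsWithin n [] p xs _ xs<n _ _ _ =
  trans (cong (λ ys → toList (gaps p ys n)) (filterB-cong-local (p <ᵇ_) (between p n) xs (All.map below-n xs<n)))
        (sym (Listₚ.++-identityʳ _))
  where
  below-n : ∀ {y} → y < n → (p <ᵇ y) ≡ between p n y
  below-n {y} y<n = sym (trans (cong ((p <ᵇ y) ∧_) (<ᵇ-true y<n)) (Boolₚ.∧-identityʳ (p <ᵇ y)))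
gaps-above≡concatMap-gapsWithin n (x ∷ ds) p xs sorted xs<n d-sorted (p<x ∷ _) (x∈xs ∷ ds∈xs) = begin
  toList (gaps p (filterB (p <ᵇ_) xs) n)
    ≡⟨ cong (λ ys → toList (gaps p ys n)) (filterB-above-split p x xs p<x sorted x∈xs) ⟩
  toList (gaps p (within p x xs ++ x ∷ filterB (x <ᵇ_) xs) n)
    ≡⟨ gaps-++ p (within p x xs) x (filterB (x <ᵇ_) xs) n ⟩
  gapsWithin xs (p , x) ++ toList (gaps x (filterB (x <ᵇ_) xs) n)
    ≡⟨ cong (gapsWithin xs (p , x) ++_)
            (gaps-above≡concatMap-gapsWithin n ds x xs sorted xs<n (Linked.tail d-sorted) (Linked⇒All-head d-sorted) ds∈xs) ⟩
  gapsWithin xs (p , x) ++ concatMap (gapsWithin xs) (blocks x ds n)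
    ∎
  where open ≡-Reasoning

blockLength : ℕ × ℕ → ℕ
blockLength (lo , hi) = hi ∸ lo

gaps≡map-blockLength : ∀ p d n → toList (gaps p d n) ≡ map blockLength (blocks p d n)
gaps≡map-blockLength p [] n = refl
gaps≡map-blockLength p (x ∷ xs) n = cong ((x ∸ p) ∷_) (gaps≡map-blockLength x xs n)

blocks-ordered : ∀ p d n → Linked _<_ d → All (p <_) d → All (_< n) d → p ≤ n →
  All (λ b → proj₁ b ≤ proj₂ b) (blocks p d n)
blocks-ordered p [] n _ _ _ p≤n = p≤n ∷ []
blocks-ordered p (x ∷ xs) n sorted (p<x ∷ _) (x<n ∷ xs<n) _ =
  ℕₚ.<⇒≤ p<x ∷ blocks-ordered x xs n (Linked.tail sorted) (Linked⇒All-head sorted) xs<n (ℕₚ.<⇒≤ x<n)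

blockGaps : List ℕ → ℕ × ℕ → List ℕ
blockGaps dstar (lo , hi) = toList (gaps 0 (subRef dstar lo hi) (hi ∸ lo))

within-above : ∀ lo hi xs → All (lo <_) (within lo hi xs)
within-above lo hi xs = All.map (λ bt → <ᵇ-true⁻ (proj₁ (∧-true⁻ bt))) (filterB-satisfies (between lo hi) xs)

within-below : ∀ lo hi xs → All (_< hi) (within lo hi xs)
within-below lo hi xs = All.map (λ bt → <ᵇ-true⁻ (proj₂ (∧-true⁻ bt))) (filterB-satisfies (between lo hi) xs)

gapsWithin≡blockGaps : ∀ dstar b → gapsWithin dstar b ≡ blockGaps dstar b
gapsWithin≡blockGaps dstar (lo , hi) =
  trans (gaps-∸ (within lo hi dstar) lo lo hi ℕₚ.≤-refl (All.map ℕₚ.<⇒≤ (within-above lo hi dstar)))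
        (cong (λ z → toList (gaps z (subRef dstar lo hi) (hi ∸ lo))) (ℕₚ.n∸n≡0 lo))

sum-blockGaps : ∀ dstar lo hi → Linked _<_ dstar → lo ≤ hi → sum (blockGaps dstar (lo , hi)) ≡ hi ∸ lo
sum-blockGaps dstar lo hi sorted lo≤hi = trans (cong sum (sym (gapsWithin≡blockGaps dstar (lo , hi))))
  (sum-gaps-from (within lo hi dstar) lo hi (filterB-Linked _ dstar sorted)
    (within-above lo hi dstar) (All.map ℕₚ.<⇒≤ (within-below lo hi dstar)) lo≤hi)

compSeries : List (ℕ → ℕ) → Series
compSeries fs m = + compSum fs m

compSeries-[] : compSeries [] ≈S oneS
compSeries-[] zero = refl
compSeries-[] (suc m) = refl

compSeries-∷ : ∀ f fs → compSeries (f ∷ fs) ≈S (λ m → + f m) ⊛ compSeries fs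
compSeries-∷ f fs m = trans (sumToℕ-ℤ m _) (sumTo-cong m (λ j _ → ℤₚ.pos-* (f j) (compSum fs (m ∸ j))))

Δ*-concatMap-compSeries : ∀ {X : Set} (f : X → ℕ → ℕ) (as bs : X → List ℕ) xs →
  All (λ x → Δ* (as x) (λ m → + f x m) ≈S Δ* (bs x) oneS) xs →
  Δ* (concatMap as xs) (compSeries (map f xs)) ≈S Δ* (concatMap bs xs) oneS
Δ*-concatMap-compSeries f as bs [] [] = compSeries-[]
Δ*-concatMap-compSeries f as bs (x ∷ xs) (eq ∷ eqs) =
  ≈S-trans (Δ*-cong (concatMap as (x ∷ xs)) (compSeries-∷ (f x) (map f xs)))
  (≈S-trans (Δ*-++-⊛ (as x) (concatMap as xs) _ _)
  (≈S-trans (⊛-cong eq (Δ*-concatMap-compSeries f as bs xs eqs))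
  (≈S-trans (≈S-sym (Δ*-++-⊛ (bs x) (concatMap bs xs) oneS oneS))
            (Δ*-cong (concatMap bs (x ∷ xs)) (oneS-⊛ oneS)))))

Δ*-at-0 : ∀ ks f → All (0 <_) ks → Δ* ks f 0 ≡ f 0
Δ*-at-0 [] f [] = refl
Δ*-at-0 (k ∷ ks) f (0<k ∷ pos) =
  trans (cong (λ z → Δ* ks f 0 ℤ.- z) (shift-> k (Δ* ks f) 0<k))
        (trans (ℤₚ.+-identityʳ _) (Δ*-at-0 ks f pos))

blockFactor : List ℕ → ℕ × ℕ → ℕ → ℕ
blockFactor dstar b j = I (proj₂ b ∸ proj₁ b) (subRef dstar (proj₁ b) (proj₂ b)) j

blockFactors≡map : ∀ n d dstar → blockFactors n d dstar ≡ map (blockFactor dstar) (blocks 0 d n)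
blockFactors≡map n d dstar = Listₚ.map-cong (λ _ → refl) (blocks 0 d n)

Δ*-blockFactor : ∀ dstar → Linked _<_ dstar → ∀ bs → All (λ b → proj₁ b ≤ proj₂ b) bs →
  All (λ b → Δ* (concatMap oneTo (blockGaps dstar b)) (λ m → + blockFactor dstar b m) ≈S Δ* (oneTo (blockLength b)) oneS) bs
Δ*-blockFactor dstar sorted [] [] = []
Δ*-blockFactor dstar sorted ((lo , hi) ∷ bs) (lo≤hi ∷ ordered) =
  Δ*-wordSeries (hi ∸ lo) _ (gaps 0 (subRef dstar lo hi) (hi ∸ lo)) (sum-blockGaps dstar lo hi sorted lo≤hi)
  ∷ Δ*-blockFactor dstar sorted bs ordered

concatMap-concatMap : ∀ {A B C : Set} (f : B → List C) (g : A → List B) xs →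
  concatMap f (concatMap g xs) ≡ concatMap (λ x → concatMap f (g x)) xs
concatMap-concatMap f g [] = refl
concatMap-concatMap f g (x ∷ xs) =
  trans (Listₚ.concatMap-++ f (g x) (concatMap g xs)) (cong (concatMap f (g x) ++_) (concatMap-concatMap f g xs))

module _ {n : ℕ} {d dstar : List ℕ} (valid : Valid n d) (refines : Refines n dstar d) where

  private
    d-sorted = proj₁ valid
    d-positive = proj₁ (proj₂ valid)
    d-bounded = proj₂ (proj₂ valid)
    dstar-valid = proj₁ refines
    dstar-sorted = proj₁ dstar-valid
    dstar-positive = proj₁ (proj₂ dstar-valid)
    dstar-bounded = proj₂ (proj₂ dstar-valid)
    d⊆dstar = proj₂ refines
    bs = blocks 0 d n
    c = gaps 0 d n
    cstar = gaps 0 dstar n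
    blockProduct = compSeries (blockFactors n d dstar)
    starFactors = concatMap (λ b → concatMap oneTo (blockGaps dstar b)) bs
    blockLengthFactors = concatMap (λ b → oneTo (blockLength b)) bs

  factorialFactors-refinement : factorialFactors cstar ≡ starFactors
  factorialFactors-refinement = begin
    concatMap oneTo (toList (gaps 0 dstar n))
      ≡⟨ cong (λ ds → concatMap oneTo (toList (gaps 0 ds n)))
              (sym (filterB-all-true (0 <ᵇ_) dstar (All.map <ᵇ-true dstar-positive))) ⟩
    concatMap oneTo (toList (gaps 0 (filterB (0 <ᵇ_) dstar) n))
      ≡⟨ cong (concatMap oneTo) (gaps-above≡concatMap-gapsWithin n d 0 dstar
            dstar-sorted dstar-bounded d-sorted d-positive d⊆dstar) ⟩
    concatMap oneTo (concatMap (gapsWithin dstar) bs)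
      ≡⟨ cong (concatMap oneTo) (Listₚ.concatMap-cong (gapsWithin≡blockGaps dstar) bs) ⟩
    concatMap oneTo (concatMap (blockGaps dstar) bs)
      ≡⟨ concatMap-concatMap oneTo (blockGaps dstar) bs ⟩
    starFactors
      ∎
    where open ≡-Reasoning

  factorialFactors-blocks : factorialFactors c ≡ blockLengthFactors
  factorialFactors-blocks = trans (cong (concatMap oneTo) (gaps≡map-blockLength 0 d n)) (Listₚ.concatMap-map oneTo blockLength bs)

  Δ*-blockProduct : Δ* starFactors blockProduct ≈S Δ* blockLengthFactors oneS
  Δ*-blockProduct =
    ≈S-trans (λ m → cong (λ fs → Δ* starFactors (compSeries fs) m) (blockFactors≡map n d dstar))
    (Δ*-concatMap-compSeries (blockFactor dstar) (λ b → concatMap oneTo (blockGaps dstar b)) (λ b → oneTo (blockLength b)) bs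
      (Δ*-blockFactor dstar dstar-sorted bs (blocks-ordered 0 d n d-sorted d-positive d-bounded z≤n)))

  -- Both sides become Π_{j ≤ n} (1 - t^j) after multiplying by Π_{j ∈ factorialFactors c*} (1 - t^j),
  -- which factors over the blocks of d.
  wordSeries-refinement : wordSeries (suc (length dstar)) n cstar ≈S blockProduct ⊛ wordSeries (suc (length d)) n c
  wordSeries-refinement = Δ*-injective (factorialFactors cstar) (factorialFactors-positive cstar)
    (≈S-trans (Δ*-wordSeries n _ cstar (sum-gaps n dstar dstar-valid)) (≈S-sym (begin
      Δ* (factorialFactors cstar) (blockProduct ⊛ W)
        ≈⟨ (λ m → cong (λ ks → Δ* ks (blockProduct ⊛ W) m) factorialFactors-refinement) ⟩
      Δ* starFactors (blockProduct ⊛ W)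
        ≈⟨ ≈S-sym (Δ*-⊛ starFactors blockProduct W) ⟩
      Δ* starFactors blockProduct ⊛ W
        ≈⟨ ⊛-cong Δ*-blockProduct (≈S-refl {W}) ⟩
      Δ* blockLengthFactors oneS ⊛ W
        ≈⟨ Δ*-⊛ blockLengthFactors oneS W ⟩
      Δ* blockLengthFactors (oneS ⊛ W)
        ≈⟨ Δ*-cong blockLengthFactors (oneS-⊛ W) ⟩
      Δ* blockLengthFactors W
        ≈⟨ (λ m → cong (λ ks → Δ* ks W m) (sym factorialFactors-blocks)) ⟩
      Δ* (factorialFactors c) W
        ≈⟨ Δ*-wordSeries n _ c (sum-gaps n d valid) ⟩
      Δ* (oneTo n) oneS
        ∎)))
    where
    W = wordSeries (suc (length d)) n c
    open SeriesReasoning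

  blockProduct-0 : blockProduct 0 ≡ + 1
  blockProduct-0 = begin
    blockProduct 0                       ≡⟨ Δ*-at-0 starFactors blockProduct (subst (All (0 <_)) factorialFactors-refinement (factorialFactors-positive cstar)) ⟨
    Δ* starFactors blockProduct 0        ≡⟨ Δ*-blockProduct 0 ⟩
    Δ* blockLengthFactors oneS 0         ≡⟨ Δ*-at-0 blockLengthFactors oneS (subst (All (0 <_)) factorialFactors-blocks (factorialFactors-positive c)) ⟩
    + 1                                  ∎
    where open ≡-Reasoning

sumTo-split : ∀ k (F : ℕ → ℤ) → sumTo k F ≡ F 0 ℤ.+ sumℤ (map F (oneTo k))
sumTo-split zero F = sym (ℤₚ.+-identityʳ (F 0))
sumTo-split (suc k) F = begin
  sumTo k F ℤ.+ F (suc k)                                 ≡⟨ cong (ℤ._+ F (suc k)) (sumTo-split k F) ⟩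
  F 0 ℤ.+ sumℤ (map F (oneTo k)) ℤ.+ F (suc k)            ≡⟨ ℤₚ.+-assoc (F 0) _ _ ⟩
  F 0 ℤ.+ (sumℤ (map F (oneTo k)) ℤ.+ F (suc k))          ≡⟨ cong (λ z → F 0 ℤ.+ (sumℤ (map F (oneTo k)) ℤ.+ z)) (ℤₚ.+-identityʳ (F (suc k))) ⟨
  F 0 ℤ.+ (sumℤ (map F (oneTo k)) ℤ.+ sumℤ (map F (suc k ∷ [])))
                                                          ≡⟨ cong (λ z → F 0 ℤ.+ z) (sumℤ-map-++ F (oneTo k) (suc k ∷ [])) ⟨
  F 0 ℤ.+ sumℤ (map F (oneTo k ∷ʳ suc k))                 ≡⟨ cong (λ ks → F 0 ℤ.+ sumℤ (map F ks)) (oneTo-suc k) ⟨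
  F 0 ℤ.+ sumℤ (map F (oneTo (suc k)))                    ∎
  where open ≡-Reasoning

sumℤ-map-+ : ∀ {A : Set} (f : A → ℕ) xs → sumℤ (map (λ x → + f x) xs) ≡ + sum (map f xs)
sumℤ-map-+ f [] = refl
sumℤ-map-+ f (x ∷ xs) = trans (cong (λ z → + f x ℤ.+ z) (sumℤ-map-+ f xs)) (sym (ℤₚ.pos-+ (f x) _))

I-refinement : (n : ℕ) → 0 < n → (d dstar : List ℕ) → Valid n d → Refines n dstar d → (k : ℕ) →
  (+ I n d k ≡ + I n dstar k ℤ.-
      sumℤ (map (λ m → + compSum (blockFactors n d dstar) m ℤ.* + I n d (k ∸ m)) (oneTo k)))
  × (I n d k ≤ I n dstar k)
I-refinement n _ d dstar valid refines k =
  trans (sym (cancel (+ I n d k) correction)) (cong (ℤ._- correction) (sym Istar≡)) ,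
  subst (I n d k ≤_) (ℤₚ.+-injective (sym (trans Istar≡ (trans (cong (λ z → + I n d k ℤ.+ z) correction≡sum)
                                                                (sym (ℤₚ.pos-+ (I n d k) _))))))
        (ℕₚ.m≤m+n (I n d k) _)
  where
  cancel : ∀ (x y : ℤ) → (x ℤ.+ y) ℤ.- y ≡ x
  cancel = solve-∀
  term = λ m → compSum (blockFactors n d dstar) m * I n d (k ∸ m)
  correction = sumℤ (map (λ m → + compSum (blockFactors n d dstar) m ℤ.* + I n d (k ∸ m)) (oneTo k))
  correction≡sum : correction ≡ + sum (map term (oneTo k))
  correction≡sum = trans (sumℤ-map-cong (oneTo k) (λ m → sym (ℤₚ.pos-* (compSum (blockFactors n d dstar) m) (I n d (k ∸ m)))))
                       (sumℤ-map-+ term (oneTo k))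
  Istar≡ : + I n dstar k ≡ + I n d k ℤ.+ correction
  Istar≡ = begin
    + I n dstar k
      ≡⟨ wordSeries-refinement valid refines k ⟩
    sumTo k (λ m → compSeries (blockFactors n d dstar) m ℤ.* + I n d (k ∸ m))
      ≡⟨ sumTo-split k _ ⟩
    compSeries (blockFactors n d dstar) 0 ℤ.* + I n d k ℤ.+ correction
      ≡⟨ cong (λ z → z ℤ.* + I n d k ℤ.+ correction) (blockProduct-0 valid refines) ⟩
    + 1 ℤ.* + I n d k ℤ.+ correction
      ≡⟨ cong (ℤ._+ correction) (ℤₚ.*-identityˡ (+ I n d k)) ⟩
    + I n d k ℤ.+ correction
      ∎
    where open ≡-Reasoning

-- Symmetry, positivity and part (v)

-- reflect N f is t^N f(1/t), for f vanishing above degree N.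
reflect : ℕ → Series → Series
reflect N f m = if m ≤ᵇ N then f (N ∸ m) else + 0

VanishesAbove : ℕ → Series → Set
VanishesAbove N f = ∀ m → N < m → f m ≡ + 0

reflect-≤ : ∀ N f {m} → m ≤ N → reflect N f m ≡ f (N ∸ m)
reflect-≤ N f m≤N rewrite ≤ᵇ-true m≤N = refl

reflect-> : ∀ N f {m} → N < m → reflect N f m ≡ + 0
reflect-> N f N<m rewrite ≤ᵇ-false N<m = refl

reflect-cong : ∀ N {f g} → f ≈S g → reflect N f ≈S reflect N g
reflect-cong N f≈g m with m ≤ᵇ N
... | true = f≈g (N ∸ m)
... | false = refl

Δ-vanishesAbove : ∀ N k f → VanishesAbove N f → VanishesAbove (N + k) (Δ k f)
Δ-vanishesAbove N k f f-vanish m N+k<m with ℕₚ.≤-<-connex k m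
... | inj₁ k≤m = cong₂ ℤ._-_ (f-vanish m N<m) (trans (shift-≤ k f k≤m) (f-vanish (m ∸ k) N<m∸k))
  where
  N<m = ℕₚ.≤-<-trans (ℕₚ.m≤m+n N k) N+k<m
  N<m∸k = ℕₚ.+-cancelʳ-< k N (m ∸ k) (subst (N + k <_) (sym (ℕₚ.m∸n+n≡m k≤m)) N+k<m)
... | inj₂ m<k = cong₂ ℤ._-_ (f-vanish m (ℕₚ.≤-<-trans (ℕₚ.m≤m+n N k) N+k<m)) (shift-> k f m<k)

+-rotate : ∀ a b c → a + b + c ≡ a + (c + b)
+-rotate a b c = trans (ℕₚ.+-assoc a b c) (cong (_+_ a) (ℕₚ.+-comm b c))

Δ*-vanishesAbove : ∀ N ks f → VanishesAbove N f → VanishesAbove (N + sum ks) (Δ* ks f)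
Δ*-vanishesAbove N [] f f-vanish = subst (λ M → VanishesAbove M f) (sym (ℕₚ.+-identityʳ N)) f-vanish
Δ*-vanishesAbove N (k ∷ ks) f f-vanish =
  subst (λ M → VanishesAbove M (Δ* (k ∷ ks) f)) (+-rotate N (sum ks) k)
        (Δ-vanishesAbove (N + sum ks) k (Δ* ks f) (Δ*-vanishesAbove N ks f f-vanish))

shift-reflect : ∀ N k f → VanishesAbove N f → shift k (reflect N f) ≈S reflect (N + k) f
shift-reflect N k f f-vanish m with ℕₚ.≤-<-connex k m
... | inj₂ m<k = trans (shift-> k (reflect N f) m<k) (sym (trans (reflect-≤ (N + k) f m≤N+k) (f-vanish _ N<N+k∸m)))
  where
  m≤N+k = ℕₚ.≤-trans (ℕₚ.<⇒≤ m<k) (ℕₚ.m≤n+m k N)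
  N<N+k∸m = ℕₚ.+-cancelʳ-< m N (N + k ∸ m) (subst (N + m <_) (sym (ℕₚ.m∸n+n≡m m≤N+k)) (ℕₚ.+-monoʳ-< N m<k))
... | inj₁ k≤m with ℕₚ.≤-<-connex m (N + k)
...   | inj₁ m≤N+k = begin
  shift k (reflect N f) m   ≡⟨ shift-≤ k (reflect N f) k≤m ⟩
  reflect N f (m ∸ k)       ≡⟨ reflect-≤ N f m∸k≤N ⟩
  f (N ∸ (m ∸ k))           ≡⟨ cong f index ⟩
  f (N + k ∸ m)             ≡⟨ reflect-≤ (N + k) f m≤N+k ⟨
  reflect (N + k) f m       ∎
  where
  open ≡-Reasoning
  m∸k≤N = ℕₚ.m≤n+o⇒m∸n≤o m k (subst (m ≤_) (ℕₚ.+-comm N k) m≤N+k)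
  index : N ∸ (m ∸ k) ≡ N + k ∸ m
  index = sym (trans (cong (N + k ∸_) (sym (ℕₚ.m+[n∸m]≡n k≤m)))
                     (trans (sym (ℕₚ.∸-+-assoc (N + k) k (m ∸ k))) (cong (_∸ (m ∸ k)) (ℕₚ.m+n∸n≡m N k))))
...   | inj₂ N+k<m = trans (shift-≤ k (reflect N f) k≤m) (trans (reflect-> N f N<m∸k) (sym (reflect-> (N + k) f N+k<m)))
  where
  N<m∸k = ℕₚ.+-cancelʳ-< k N (m ∸ k) (subst (N + k <_) (sym (ℕₚ.m∸n+n≡m k≤m)) N+k<m)

shift-at-reflected : ∀ N k f m → m ≤ N + k → shift k f (N + k ∸ m) ≡ reflect N f m
shift-at-reflected N k f m m≤N+k with ℕₚ.≤-<-connex m N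
... | inj₁ m≤N = trans (shift-≤ k f k≤N+k∸m) (trans (cong f index) (sym (reflect-≤ N f m≤N)))
  where
  k≤N+k∸m = ℕₚ.m+n≤o⇒m≤o∸n k (subst (_≤ N + k) (ℕₚ.+-comm m k) (ℕₚ.+-monoˡ-≤ k m≤N))
  index : N + k ∸ m ∸ k ≡ N ∸ m
  index = trans (ℕₚ.∸-+-assoc (N + k) m k) (trans (cong (N + k ∸_) (ℕₚ.+-comm m k))
            (trans (sym (ℕₚ.∸-+-assoc (N + k) k m)) (cong (_∸ m) (ℕₚ.m+n∸n≡m N k))))
... | inj₂ N<m = trans (shift-> k f N+k∸m<k) (sym (reflect-> N f N<m))
  where
  N+k∸m<k = ℕₚ.+-cancelʳ-< m (N + k ∸ m) k (subst (_< k + m) (sym (ℕₚ.m∸n+n≡m m≤N+k))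
              (subst (_< k + m) (ℕₚ.+-comm k N) (ℕₚ.+-monoʳ-< k N<m)))

reflect-Δ : ∀ N k f m → reflect (N + k) (Δ k f) m ≡ reflect (N + k) f m ℤ.- reflect N f m
reflect-Δ N k f m with ℕₚ.≤-<-connex m (N + k)
... | inj₁ m≤N+k = trans (reflect-≤ (N + k) (Δ k f) m≤N+k)
                         (cong₂ ℤ._-_ (sym (reflect-≤ (N + k) f m≤N+k)) (shift-at-reflected N k f m m≤N+k))
... | inj₂ N+k<m = trans (reflect-> (N + k) (Δ k f) N+k<m)
                         (sym (cong₂ ℤ._-_ (reflect-> (N + k) f N+k<m) (reflect-> N f (ℕₚ.≤-<-trans (ℕₚ.m≤m+n N k) N+k<m))))

Δ-reflect : ∀ N k f → VanishesAbove N f → Δ k (reflect N f) ≈S -S reflect (N + k) (Δ k f)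
Δ-reflect N k f f-vanish m =
  trans (cong (λ z → reflect N f m ℤ.- z) (shift-reflect N k f f-vanish m))
        (sym (trans (cong ℤ.-_ (reflect-Δ N k f m)) (negate-difference (reflect (N + k) f m) (reflect N f m))))
  where
  negate-difference : ∀ (x y : ℤ) → ℤ.- (x ℤ.- y) ≡ y ℤ.- x
  negate-difference = solve-∀

Δ*-reflect : ∀ N ks f → VanishesAbove N f →
  Δ* ks (reflect N f) ≈S sgn (length ks) ·S reflect (N + sum ks) (Δ* ks f)
Δ*-reflect N [] f _ m = trans (cong (λ M → reflect M f m) (sym (ℕₚ.+-identityʳ N))) (sym (ℤₚ.*-identityˡ _))
Δ*-reflect N (k ∷ ks) f f-vanish =
  ≈S-trans (Δ-cong k (Δ*-reflect N ks f f-vanish))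
  (≈S-trans (Δ-·S k (sgn (length ks)) (reflect (N + sum ks) (Δ* ks f)))
  (λ m → trans (cong (λ z → sgn (length ks) ℤ.* z) (Δ-reflect (N + sum ks) k (Δ* ks f) (Δ*-vanishesAbove N ks f f-vanish) m))
    (trans (sym (ℤₚ.neg-distribʳ-* (sgn (length ks)) _)) (trans (ℤₚ.neg-distribˡ-* (sgn (length ks)) _)
    (cong (λ M → ℤ.- sgn (length ks) ℤ.* reflect M (Δ k (Δ* ks f)) m) (+-rotate N (sum ks) k))))))

ν-vec : ∀ {a} → Vec ℕ a → ℕ
ν-vec c = pairSum (toList c)

triangle : ℕ → ℕ
triangle m = sum (oneTo m)

sum-map-+ : ∀ a xs → sum (map (_+_ a) xs) ≡ a * length xs + sum xs
sum-map-+ a [] = sym (cong (_+ 0) (ℕₚ.*-zeroʳ a))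
sum-map-+ a (x ∷ xs) = trans (cong (_+_ (a + x)) (sum-map-+ a xs)) (regroup a x (length xs) (sum xs))
  where
  regroup : ∀ a x l s → a + x + (a * l + s) ≡ a * suc l + (x + s)
  regroup = ℕ-Solver.solve-∀

triangle-+ : ∀ a b → triangle (a + b) ≡ triangle a + (a * b + triangle b)
triangle-+ a b = trans (cong sum (oneTo-+ a b)) (trans (Sumₚ.sum-++ (oneTo a) _)
  (cong (_+_ (triangle a)) (trans (sum-map-+ a (oneTo b)) (cong (λ l → a * l + triangle b) (length-oneTo b)))))

triangle-suc : ∀ m → triangle (suc m) ≡ triangle m + suc m
triangle-suc m = trans (cong sum (oneTo-suc m))
  (trans (Sumₚ.sum-++ (oneTo m) (suc m ∷ [])) (cong (_+_ (triangle m)) (ℕₚ.+-identityʳ (suc m))))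

pairSum+sum-factorialFactors : ∀ xs → pairSum xs + sum (concatMap oneTo xs) ≡ triangle (sum xs)
pairSum+sum-factorialFactors [] = refl
pairSum+sum-factorialFactors (x ∷ xs) = begin
  x * sum xs + pairSum xs + sum (oneTo x ++ concatMap oneTo xs)
    ≡⟨ cong (_+_ (x * sum xs + pairSum xs)) (Sumₚ.sum-++ (oneTo x) (concatMap oneTo xs)) ⟩
  x * sum xs + pairSum xs + (triangle x + sum (concatMap oneTo xs))
    ≡⟨ regroup (x * sum xs) (pairSum xs) (triangle x) (sum (concatMap oneTo xs)) ⟩
  triangle x + (x * sum xs + (pairSum xs + sum (concatMap oneTo xs)))
    ≡⟨ cong (λ z → triangle x + (x * sum xs + z)) (pairSum+sum-factorialFactors xs) ⟩
  triangle x + (x * sum xs + triangle (sum xs))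
    ≡⟨ triangle-+ x (sum xs) ⟨
  triangle (x + sum xs)
    ∎
  where
  open ≡-Reasoning
  regroup : ∀ a b c d → a + b + (c + d) ≡ c + (a + (b + d))
  regroup = ℕ-Solver.solve-∀

length-factorialFactors : ∀ xs → length (concatMap oneTo xs) ≡ sum xs
length-factorialFactors [] = refl
length-factorialFactors (x ∷ xs) = trans (Listₚ.length-++ (oneTo x)) (cong₂ _+_ (length-oneTo x) (length-factorialFactors xs))

sgn-involutive : ∀ n z → sgn n ℤ.* (sgn n ℤ.* z) ≡ z
sgn-involutive zero z = trans (ℤₚ.*-identityˡ _) (ℤₚ.*-identityˡ z)
sgn-involutive (suc n) z = trans (neg-neg (sgn n) z) (sgn-involutive n z)
  where
  neg-neg : ∀ (s z : ℤ) → (ℤ.- s) ℤ.* ((ℤ.- s) ℤ.* z) ≡ s ℤ.* (s ℤ.* z)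
  neg-neg = solve-∀

reflect-0-oneS : reflect 0 oneS ≈S oneS
reflect-0-oneS zero = refl
reflect-0-oneS (suc m) = refl

oneS-vanishesAbove : VanishesAbove 0 oneS
oneS-vanishesAbove (suc m) _ = refl

reflect-Δ*-oneTo : ∀ n → reflect (triangle n) (Δ* (oneTo n) oneS) ≈S sgn n ·S Δ* (oneTo n) oneS
reflect-Δ*-oneTo n m = sym (trans (cong (λ z → sgn n ℤ.* z) (Δ*≈ m)) (sgn-involutive n _))
  where
  Δ*≈ : Δ* (oneTo n) oneS ≈S sgn n ·S reflect (triangle n) (Δ* (oneTo n) oneS)
  Δ*≈ = ≈S-trans (Δ*-cong (oneTo n) (≈S-sym reflect-0-oneS))
    (≈S-trans (Δ*-reflect 0 (oneTo n) oneS oneS-vanishesAbove)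
              (λ m → cong (λ l → sgn l ℤ.* reflect (triangle n) (Δ* (oneTo n) oneS) m) (length-oneTo n)))

-- Reflecting the q-multinomial identity: both Δ*-factors pick up the same sign (-1)^n.
reflect-wordSeries : ∀ n a (c : Vec ℕ a) → sum (toList c) ≡ n → VanishesAbove (ν-vec c) (wordSeries a n c) →
  reflect (ν-vec c) (wordSeries a n c) ≈S wordSeries a n c
reflect-wordSeries n a c Σc≡n W-vanish =
  Δ*-injective ks (factorialFactors-positive c) (≈S-trans Δ*-reflected (≈S-sym (Δ*-wordSeries n a c Σc≡n)))
  where
  ks = factorialFactors c
  W = wordSeries a n c
  Δ*-reflected : Δ* ks (reflect (ν-vec c) W) ≈S Δ* (oneTo n) oneS
  Δ*-reflected = ≈S-trans (Δ*-reflect (ν-vec c) ks W W-vanish) (λ m → begin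
    sgn (length ks) ℤ.* reflect (ν-vec c + sum ks) (Δ* ks W) m
      ≡⟨ cong₂ (λ l N → sgn l ℤ.* reflect N (Δ* ks W) m)
               (trans (length-factorialFactors (toList c)) Σc≡n)
               (trans (pairSum+sum-factorialFactors (toList c)) (cong triangle Σc≡n)) ⟩
    sgn n ℤ.* reflect (triangle n) (Δ* ks W) m
      ≡⟨ cong (λ z → sgn n ℤ.* z) (reflect-cong (triangle n) (Δ*-wordSeries n a c Σc≡n) m) ⟩
    sgn n ℤ.* reflect (triangle n) (Δ* (oneTo n) oneS) m
      ≡⟨ cong (λ z → sgn n ℤ.* z) (reflect-Δ*-oneTo n m) ⟩
    sgn n ℤ.* (sgn n ℤ.* Δ* (oneTo n) oneS m)
      ≡⟨ sgn-involutive n _ ⟩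
    Δ* (oneTo n) oneS m
      ∎)
    where open ≡-Reasoning

ν-vec-decrementAt : ∀ {a} (c : Vec ℕ a) x → 1 ≤ lookup c x → ν-vec (decrementAt c x) + countBelow c x ≤ ν-vec c
ν-vec-decrementAt (suc c₀ ∷ c) zero _ =
  subst (_≤ sum (toList c) + c₀ * sum (toList c) + ν-vec c) (sym (ℕₚ.+-identityʳ _))
        (ℕₚ.+-monoˡ-≤ (ν-vec c) (ℕₚ.m≤n+m (c₀ * sum (toList c)) (sum (toList c))))
ν-vec-decrementAt (c₀ ∷ c) (suc x) 1≤cₓ =
  subst (λ z → c₀ * s + ν-vec (decrementAt c x) + (c₀ + countBelow c x) ≤ c₀ * z + ν-vec c) (sum-decrementAt c x 1≤cₓ)
    (subst (_≤ c₀ * suc s + ν-vec c) (sym (regroup c₀ s (ν-vec (decrementAt c x)) (countBelow c x)))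
      (ℕₚ.+-monoʳ-≤ (c₀ * suc s) (ν-vec-decrementAt c x 1≤cₓ)))
  where
  s = sum (toList (decrementAt c x))
  regroup : ∀ c₀ s v p → c₀ * s + v + (c₀ + p) ≡ c₀ * suc s + (v + p)
  regroup = ℕ-Solver.solve-∀

wordCount-vanishesAbove : ∀ n a (c : Vec ℕ a) k → ν-vec c < k → wordCount a n c k ≡ 0
wordCount-vanishesAbove zero a c (suc k) _ =
  cong (λ b → (if b then 1 else 0) + 0) (Boolₚ.∧-zeroʳ (allB (λ i → 0 ≡ᵇ lookup c i) (allFin a)))
wordCount-vanishesAbove (suc n) a c k ν<k = trans (wordCount-suc a n c k) (sumFin-zero a term)
  where
  term : ∀ x → (if (1 ≤ᵇ lookup c x) ∧ (countBelow c x ≤ᵇ k)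
                then wordCount a n (decrementAt c x) (k ∸ countBelow c x) else 0) ≡ 0
  term x with 1 ≤ᵇ lookup c x in 1≤cₓ | countBelow c x ≤ᵇ k
  ... | false | _ = refl
  ... | true | false = refl
  ... | true | true = wordCount-vanishesAbove n a (decrementAt c x) (k ∸ countBelow c x)
    (ℕₚ.m+n≤o⇒m≤o∸n (suc (ν-vec (decrementAt c x))) (ℕₚ.<-≤-trans (s≤s (ν-vec-decrementAt c x (≤ᵇ-true⁻ {1} 1≤cₓ))) ν<k))

-- t is slack: inversions still available from the copies of smaller letters already skipped.
FirstLetter : ∀ {a} → Vec ℕ a → ℕ → ℕ → Set
FirstLetter {a} c t k =
  Σ (Fin a) λ x → (1 ≤ lookup c x) × (countBelow c x ≤ k) × (k ∸ countBelow c x ≤ t + ν-vec (decrementAt c x))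

-- If k does not fit after using the letter 0, skip all suc c₀ copies of it and recurse.
firstLetter-skip : ∀ {a} c₀ (c : Vec ℕ a) t k s → sum (toList c) ≡ suc s →
  k ≤ t + (suc c₀ * suc s + ν-vec c) → ¬ k ≤ t + (c₀ * suc s + ν-vec c) →
  (∀ t k → 1 ≤ sum (toList c) → k ≤ t + ν-vec c → FirstLetter c t k) →
  FirstLetter (suc c₀ ∷ c) t k
firstLetter-skip c₀ c t k s Σc≡ k≤t+ν k≰ firstLetter-c
  with firstLetter-c (t + suc c₀ * s) (k ∸ suc c₀) (subst (1 ≤_) (sym Σc≡) (s≤s z≤n))
                     (ℕₚ.m≤n+o⇒m∸n≤o k (suc c₀) (subst (k ≤_) (regroup t c₀ s (ν-vec c)) k≤t+ν))
  where
  regroup : ∀ t c₀ s v → t + (suc c₀ * suc s + v) ≡ suc c₀ + (t + suc c₀ * s + v)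
  regroup = ℕ-Solver.solve-∀
... | y , 1≤c_y , below≤ , rest = suc y , 1≤c_y , below≤k , rest′
  where
  1+c₀≤k : suc c₀ ≤ k
  1+c₀≤k = ℕₚ.≤-trans (s≤s (ℕₚ.≤-trans (ℕₚ.m≤m*n c₀ (suc s))
             (ℕₚ.≤-trans (ℕₚ.m≤n+m (c₀ * suc s) t)
               (ℕₚ.+-monoʳ-≤ t (ℕₚ.m≤m+n _ (ν-vec c))))))
           (ℕₚ.≰⇒> k≰)
  below≤k : suc c₀ + countBelow c y ≤ k
  below≤k = subst (_≤ k) (ℕₚ.+-comm (countBelow c y) (suc c₀)) (ℕₚ.m≤o∸n⇒m+n≤o (countBelow c y) 1+c₀≤k below≤)
  Σc-y≡s : sum (toList (decrementAt c y)) ≡ s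
  Σc-y≡s = ℕₚ.suc-injective (trans (sum-decrementAt c y 1≤c_y) Σc≡)
  rest′ : k ∸ (suc c₀ + countBelow c y) ≤ t + ν-vec (suc c₀ ∷ decrementAt c y)
  rest′ = subst (_≤ t + (suc c₀ * sum (toList (decrementAt c y)) + ν-vec (decrementAt c y))) (ℕₚ.∸-+-assoc k (suc c₀) (countBelow c y))
            (subst (λ z → k ∸ suc c₀ ∸ countBelow c y ≤ t + (suc c₀ * z + ν-vec (decrementAt c y))) (sym Σc-y≡s)
              (subst (k ∸ suc c₀ ∸ countBelow c y ≤_) (ℕₚ.+-assoc t (suc c₀ * s) (ν-vec (decrementAt c y))) rest))

firstLetter-exists : ∀ {a} (c : Vec ℕ a) t k → 1 ≤ sum (toList c) → k ≤ t + ν-vec c → FirstLetter c t k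
firstLetter-exists (zero ∷ c) t k 1≤Σc k≤t+ν with firstLetter-exists c t k 1≤Σc k≤t+ν
... | y , 1≤c_y , below≤k , rest = suc y , 1≤c_y , below≤k , rest
firstLetter-exists (suc c₀ ∷ c) t k 1≤Σc k≤t+ν with k ℕₚ.≤? t + ν-vec (c₀ ∷ c)
... | yes fits = zero , s≤s z≤n , z≤n , fits
... | no k≰ with sum (toList c) in Σc≡
...   | zero = ⊥-elim (k≰ (subst (λ z → k ≤ t + (z + ν-vec c)) (trans (ℕₚ.*-zeroʳ (suc c₀)) (sym (ℕₚ.*-zeroʳ c₀))) k≤t+ν))
...   | suc s = firstLetter-skip c₀ c t k s Σc≡ k≤t+ν k≰ (firstLetter-exists c)

ν-vec-zero : ∀ {a} (c : Vec ℕ a) → sum (toList c) ≡ 0 → ν-vec c ≡ 0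
ν-vec-zero [] _ = refl
ν-vec-zero (zero ∷ c) Σc≡0 = ν-vec-zero c Σc≡0

wordCount-positive : ∀ n a (c : Vec ℕ a) → sum (toList c) ≡ n → ∀ k → k ≤ ν-vec c → 1 ≤ wordCount a n c k
wordCount-positive zero a c Σc≡0 k k≤ν with subst (k ≤_) (ν-vec-zero c Σc≡0) k≤ν
... | z≤n = ℕₚ.≤-reflexive (sym (ℤₚ.+-injective (wordSeries-zero a c Σc≡0 0)))
wordCount-positive (suc n) a c Σc≡1+n k k≤ν with firstLetter-exists c 0 k (subst (1 ≤_) (sym Σc≡1+n) (s≤s z≤n)) k≤ν
... | x , 1≤cₓ , below≤k , rest = begin
  1
    ≤⟨ wordCount-positive n a (decrementAt c x) (ℕₚ.suc-injective (trans (sum-decrementAt c x 1≤cₓ) Σc≡1+n))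
                          (k ∸ countBelow c x) rest ⟩
  wordCount a n (decrementAt c x) (k ∸ countBelow c x)
    ≡⟨ cong₂ (λ b₁ b₂ → if b₁ ∧ b₂ then wordCount a n (decrementAt c x) (k ∸ countBelow c x) else 0)
             (≤ᵇ-true 1≤cₓ) (≤ᵇ-true below≤k) ⟨
  (if (1 ≤ᵇ lookup c x) ∧ (countBelow c x ≤ᵇ k) then wordCount a n (decrementAt c x) (k ∸ countBelow c x) else 0)
    ≤⟨ sumFin-≥ a _ x ⟩
  sumFin a _
    ≡⟨ wordCount-suc a n c k ⟨
  wordCount a (suc n) c k
    ∎
  where open ℕₚ.≤-Reasoning

eList≡gaps : ∀ n d → eList n d ≡ toList (gaps 0 d n)
eList≡gaps n d = trans (Listₚ.map-cong (λ _ → refl) (blocks 0 d n)) (sym (gaps≡map-blockLength 0 d n))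

2*triangle : ∀ m → 2 * triangle m ≡ m * suc m
2*triangle zero = refl
2*triangle (suc m) = begin
  2 * triangle (suc m)          ≡⟨ cong (2 *_) (triangle-suc m) ⟩
  2 * (triangle m + suc m)      ≡⟨ ℕₚ.*-distribˡ-+ 2 (triangle m) (suc m) ⟩
  2 * triangle m + 2 * suc m    ≡⟨ cong (_+ 2 * suc m) (2*triangle m) ⟩
  m * suc m + 2 * suc m         ≡⟨ regroup m ⟩
  suc m * suc (suc m)           ∎
  where
  open ≡-Reasoning
  regroup : ∀ m → m * suc m + 2 * suc m ≡ suc m * suc (suc m)
  regroup = ℕ-Solver.solve-∀

m≤triangle : ∀ m → m ≤ triangle m
m≤triangle zero = z≤n
m≤triangle (suc m) = subst (suc m ≤_) (sym (triangle-suc m)) (ℕₚ.m≤n+m (suc m) (triangle m))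

sum≤sum-factorialFactors : ∀ xs → sum xs ≤ sum (concatMap oneTo xs)
sum≤sum-factorialFactors [] = z≤n
sum≤sum-factorialFactors (x ∷ xs) =
  subst (x + sum xs ≤_) (sym (Sumₚ.sum-++ (oneTo x) (concatMap oneTo xs)))
        (ℕₚ.+-mono-≤ (m≤triangle x) (sum≤sum-factorialFactors xs))

≤-half-pairs : ∀ v n p → n ≤ p → v + p ≡ triangle n → v ≤ (n * (n ∸ 1)) / 2
≤-half-pairs v n p n≤p v+p≡ = subst (_≤ (n * (n ∸ 1)) / 2) (ℕ÷.m*n/n≡m v 2) (ℕ÷./-monoˡ-≤ 2 2v≤)
  where
  n*suc-n : ∀ n → n * suc n ≡ n * (n ∸ 1) + 2 * n
  n*suc-n zero = refl
  n*suc-n (suc m) = regroup m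
    where
    regroup : ∀ m → suc m * suc (suc m) ≡ suc m * m + 2 * suc m
    regroup = ℕ-Solver.solve-∀
  double : ∀ v n → 2 * (v + n) ≡ v * 2 + 2 * n
  double = ℕ-Solver.solve-∀
  2v+2n≤ : v * 2 + 2 * n ≤ n * (n ∸ 1) + 2 * n
  2v+2n≤ = subst₂ _≤_ (double v n) (trans (2*triangle n) (n*suc-n n))
                  (ℕₚ.*-monoʳ-≤ 2 (subst (v + n ≤_) v+p≡ (ℕₚ.+-monoʳ-≤ v n≤p)))
  2v≤ : v * 2 ≤ n * (n ∸ 1)
  2v≤ = ℕₚ.+-cancelʳ-≤ (2 * n) (v * 2) (n * (n ∸ 1)) 2v+2n≤

I-symmetric-positive : (n : ℕ) → 0 < n → (d : List ℕ) → Valid n d →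
  (ν n d ≤ (n * (n ∸ 1)) / 2)
  × ((k : ℕ) → I n d k ≡ Iℤ n d (+ ν n d ℤ.- + k))
  × ((k : ℕ) → k ≤ ν n d → 1 ≤ I n d k)
I-symmetric-positive n _ d valid = ν-bound , symmetric , positive
  where
  a = suc (length d)
  c = gaps 0 d n
  Σc≡n : sum (toList c) ≡ n
  Σc≡n = sum-gaps n d valid
  ν≡ : ν n d ≡ ν-vec c
  ν≡ = cong pairSum (eList≡gaps n d)
  ν-bound : ν n d ≤ (n * (n ∸ 1)) / 2
  ν-bound = subst (_≤ (n * (n ∸ 1)) / 2) (sym ν≡)
    (≤-half-pairs (ν-vec c) n (sum (factorialFactors c))
      (subst (_≤ sum (factorialFactors c)) Σc≡n (sum≤sum-factorialFactors (toList c)))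
      (trans (pairSum+sum-factorialFactors (toList c)) (cong triangle Σc≡n)))
  reflected : reflect (ν-vec c) (wordSeries a n c) ≈S wordSeries a n c
  reflected = reflect-wordSeries n a c Σc≡n (λ m ν<m → cong +_ (wordCount-vanishesAbove n a c m ν<m))
  symmetric : (k : ℕ) → I n d k ≡ Iℤ n d (+ ν n d ℤ.- + k)
  symmetric k rewrite ν≡ with ℕₚ.≤-<-connex k (ν-vec c)
  ... | inj₁ k≤ν = ℤₚ.+-injective (trans (sym (reflected k))
        (trans (reflect-≤ (ν-vec c) (wordSeries a n c) k≤ν) (cong (λ z → + Iℤ n d z) (sym (+m-+n-≥ k≤ν)))))
  ... | inj₂ ν<k = trans (wordCount-vanishesAbove n a c k ν<k) (sym (cong (Iℤ n d) (+m-+n-< ν<k)))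
  positive : (k : ℕ) → k ≤ ν n d → 1 ≤ I n d k
  positive k k≤ν = wordCount-positive n a c Σc≡n k (subst (k ≤_) ν≡ k≤ν)

theorem4 :
    -- (i)
    ((n : ℕ) → 0 < n → (w : Vec ℕ n) → All (λ x → 0 < x) (toList w) → (r : ℕ) →
      (λ m → altSubsetSum r (λ s → + Dℤ (toList w) (+ m ℤ.- + s)))
        ⊛ prodS (map oneMinusT (toList w))
        ≈S prodS (map oneMinusT (oneTo r)))
    ×
    -- (ii)
    ((n : ℕ) → 0 < n → (d : List ℕ) → Valid n d → (k : ℕ) →
      (+ I n d k ≡ altSubsetSum n (λ s → + Dℤ (ε d n) (+ k ℤ.- + s)))
      × (+ I n d k ≡ sumTo k (λ i → ψ n i ℤ.* + Dℤ (ε d n) (+ k ℤ.- + i))))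
    ×
    -- (iii)
    ((n : ℕ) → 0 < n → (k : ℕ) →
      (+ Iperm n k ≡ altSubsetSum n (λ s → + binomℤ (+ (n ∸ 1 + k) ℤ.- + s) (n ∸ 1)))
      × (+ Iperm n k ≡ sumTo k (λ i → ψ n i ℤ.* + binomℤ (+ (n ∸ 1 + k) ℤ.- + i) (n ∸ 1))))
    ×
    -- (iv)
    ((n : ℕ) → 0 < n → (d dstar : List ℕ) → Valid n d → Refines n dstar d → (k : ℕ) →
      (+ I n d k ≡ + I n dstar k ℤ.-
          sumℤ (map (λ m → + compSum (blockFactors n d dstar) m ℤ.* + I n d (k ∸ m)) (oneTo k)))
      × (I n d k ≤ I n dstar k))
    ×
    -- (v)
    ((n : ℕ) → 0 < n → (d : List ℕ) → Valid n d →
      (ν n d ≤ (n * (n ∸ 1)) / 2)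
      × ((k : ℕ) → I n d k ≡ Iℤ n d (+ ν n d ℤ.- + k))
      × ((k : ℕ) → k ≤ ν n d → 1 ≤ I n d k))
theorem4 =
  altSubsetSumD-⊛-prodS ,
  I≡altSubsetSumD ,
  Iperm≡altSubsetSumBinom ,
  I-refinement ,
  I-symmetric-positive
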